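{- Let $A\geq a\geq 1$ and $r\geq 2$ be integers. For $n\geq0$ let $\sigma\overline{mes}_{r,A,a}(n)=\sum_{\pi\in\overline{\mathcal{P}}(n)}\overline{mes}_{r,A,a}(\pi)$. Then \[ \sum_{n=0}^\infty\sigma\overline{mes}_{r,A,a}(n)q^{n} =\frac{(-q;q)_{\infty}}{(q;q)_{\infty}}\bigg[a+A\sum_{k=1}^{\infty}\frac{q^{r[A\binom{k}{2}+ka]}}{(-q^{a};q^{A})_{k}}\bigg]. \]
   Context: An overpartition is a partition (finite non-increasing sequence of positive integers) in which the first occurrence of each part value may be overlined; $\overline{\mathcal{P}}(n)$ is the set of overpartitions of $n$. A part is of size $t$ if it equals $t$ or $\overline{t}$. $(a;q)_\infty=\prod_{i\geq0}(1-aq^i)$, $(a;q)_n=(a;q)_\infty/(aq^n;q)_\infty$; $|q|<1$. For $r\geq2$, $\overline{mes}_{r,A,a}(\pi)$ is the smallest positive integer $m\equiv a\pmod A$ such that either $\pi$ has no overlined part $\overline{m}$ or $\pi$ has fewer than $r-1$ non-overlined parts equal to $m$. -}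

module Defs where

open import Data.Nat as ℕ using (ℕ; zero; suc; _≤_; _∸_; _<ᵇ_; _≡ᵇ_)
open import Data.Nat.Combinatorics using (_C_)
open import Data.Integer as ℤ using (ℤ; +_; -_; _+_; _*_; _^_)
open import Data.Bool using (Bool; true; false; if_then_else_; _∧_; _∨_; not)
open import Data.Product using (_×_; _,_; proj₁; proj₂)
open import Data.List using (List; []; _∷_; map; foldr; upTo; length)
open import Data.List.Relation.Unary.All using (All)
open import Data.List.Relation.Unary.Linked using (Linked)
open import Relation.Binary.PropositionalEquality using (_≡_)

-- A part: (size, overlined?)
Part : Set
Part = ℕ × Bool

OverPartition : Set
OverPartition = List Part

-- consecutive parts: non-increasing sizes, and a part equal in size to
-- its predecessor is not overlined (only first occurrence may be overlined)
Step : Part → Part → Set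
Step (v , _) (w , c) = (w ≤ v) × (w ≡ v → c ≡ false)

sumParts : OverPartition → ℕ
sumParts = foldr (λ p s → proj₁ p ℕ.+ s) 0

IsOverpartitionOf : ℕ → OverPartition → Set
IsOverpartitionOf n π =
  All (λ p → 1 ≤ proj₁ p) π × Linked Step π × sumParts π ≡ n

hasOver : OverPartition → ℕ → Bool
hasOver π m = foldr (λ p b → ((proj₁ p ≡ᵇ m) ∧ proj₂ p) ∨ b) false π

countNon : OverPartition → ℕ → ℕ
countNon π m =
  foldr (λ p c → (if (proj₁ p ≡ᵇ m) ∧ not (proj₂ p) then 1 else 0) ℕ.+ c) 0 π

mesCond : ℕ → OverPartition → ℕ → Bool
mesCond r π m = not (hasOver π m) ∨ (countNon π m <ᵇ r ∸ 1)

mesSearch : ℕ → ℕ → OverPartition → ℕ → ℕ → ℕ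
mesSearch r A π zero m = m
mesSearch r A π (suc f) m =
  if mesCond r π m then m else mesSearch r A π f (m ℕ.+ A)

-- For 1 ≤ a ≤ A the positive integers ≡ a (mod A) are
-- exactly a, a+A, a+2A, ...; each failing candidate needs a distinct
-- overlined part of π, so fuel length π + 1 always reaches the minimum.
mes : (r A a : ℕ) → OverPartition → ℕ
mes r A a π = mesSearch r A π (suc (length π)) a

sumℕ : List ℕ → ℕ
sumℕ = foldr ℕ._+_ 0

σmes : (r A a : ℕ) → List OverPartition → ℕ
σmes r A a L = sumℕ (map (mes r A a) L)

Series : Set
Series = ℕ → ℤ

sumℤ : List ℤ → ℤ
sumℤ = foldr _+_ (+ 0)

ι : Bool → ℤ
ι b = if b then + 1 else + 0

one : Series
one n = ι (n ≡ᵇ 0)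

mono : ℕ → Series
mono e n = ι (n ≡ᵇ e)

_⊕_ : Series → Series → Series
(f ⊕ g) n = f n + g n

scale : ℤ → Series → Series
scale c f n = c * f n

_⊛_ : Series → Series → Series
(f ⊛ g) n = sumℤ (map (λ k → f k * g (n ∸ k)) (upTo (suc n)))

sumS : List Series → Series
sumS = foldr _⊕_ (λ _ → + 0)

prodS : List Series → Series
prodS = foldr _⊛_ one

onePlus : ℕ → Series
onePlus m = one ⊕ mono m

-- 1/(1 - c q^m) = Σ_{j ≥ 0} c^j q^{m j}   (for m ≥ 1; terms with j > n
-- do not contribute to the coefficient of q^n)
geomInv : ℤ → ℕ → Series
geomInv c m n = sumℤ (map (λ j → (c ^ j) * ι (n ≡ᵇ m ℕ.* j)) (upTo (suc n)))

range1 : ℕ → List ℕ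
range1 N = map suc (upTo N)

-- ∏_{i=1}^{N} (1+q^i)/(1-q^i)   (truncation of (-q;q)_∞/(q;q)_∞)
overGF : ℕ → Series
overGF N = prodS (map onePlus (range1 N)) ⊛ prodS (map (geomInv (+ 1)) (range1 N))

invPoch : (A a k : ℕ) → Series
invPoch A a k = prodS (map (λ j → geomInv (- + 1) (a ℕ.+ j ℕ.* A)) (upTo k))

-- truncation at N of the right-hand side of Theorem 2.6
rhsTrunc : (r A a N : ℕ) → Series
rhsTrunc r A a N =
  overGF N ⊛
    (scale (+ a) one ⊕
      scale (+ A) (sumS (map (λ k → mono (r ℕ.* (A ℕ.* (k C 2) ℕ.+ k ℕ.* a)) ⊛ invPoch A a k)
                             (range1 N))))

-- Write c_j = a + jA for the candidates and call a size m blocked in π when π has the part m̄ and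
-- at least r − 1 non-overlined parts m.  Then mes(π) = a + A·#{k ≥ 1 | c_0, …, c_{k−1} are blocked in π},
-- so σmes(n) is a times the number of overpartitions of n plus A times the sum over k ≥ 1 of the
-- numbers of overpartitions of n in which c_0, …, c_{k−1} are blocked.  An overpartition is a sequence
-- of independent runs of equal parts; the runs of size s have generating function (1 + q^s)/(1 − q^s),
-- and those in which s is blocked (s̄ followed by at least r − 1 copies of s) have generating function
-- q^{rs}/(1 − q^s) = (1 + q^s)/(1 − q^s) · q^{rs}/(1 + q^s).  Blocking c_0, …, c_{k−1} therefore
-- multiplies (−q;q)_∞/(q;q)_∞ by q^{r(ka + A·C(k,2))}/(−q^a;q^A)_k.  Truncating every product at N ≥ n
-- is harmless: parts larger than N, and k with c_{k−1} > N, do not contribute to the coefficient of q^n.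

module Submission where

open import Defs
open import Algebra.Bundles using (CommutativeSemigroup)
import Algebra.Properties.CommutativeSemigroup
open import Data.Bool using (Bool; true; false; if_then_else_; _∧_; _∨_; not; T)
import Data.Bool.Properties as BP
open import Data.Empty using (⊥; ⊥-elim)
open import Data.Integer as ℤ using (ℤ; +_) renaming (_+_ to _+ᶻ_; _*_ to _*ᶻ_)
import Data.Integer.Properties as ZP
import Data.Integer.Tactic.RingSolver as ℤ-Ring
open import Data.List using (List; []; _∷_; map; upTo; length; _++_; concatMap; replicate; applyUpTo)
open import Data.List.Membership.Propositional using (_∈_; find; lose)
import Data.List.Membership.Propositional.Properties as MP
open import Data.List.Membership.Propositional.Properties.WithK using (unique∧set⇒bag)
import Data.List.Properties as LP
open import Data.List.Relation.Binary.BagAndSetEquality using (∼bag⇒↭)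
open import Data.List.Relation.Binary.Disjoint.Propositional using (Disjoint)
open import Data.List.Relation.Binary.Permutation.Propositional using (_↭_)
import Data.List.Relation.Binary.Permutation.Propositional.Properties as PermP
open import Data.List.Relation.Unary.All as All using (All; []; _∷_)
import Data.List.Relation.Unary.All.Properties as AllP
open import Data.List.Relation.Unary.AllPairs using ([]; _∷_)
open import Data.List.Relation.Unary.Any using (here; there)
open import Data.List.Relation.Unary.Linked using (Linked; []; [-]; _∷_)
open import Data.List.Relation.Unary.Unique.Propositional using (Unique)
import Data.List.Relation.Unary.Unique.Propositional.Properties as UP
open import Data.Nat as ℕ using (ℕ; zero; suc; _+_; _*_; _∸_; _≤_; _<_; z≤n; s≤s; _≡ᵇ_; _<ᵇ_; _≟_; _≤?_; _<?_)
open import Data.Nat.Combinatorics using (_C_; nCk+nC[k+1]≡[n+1]C[k+1]; nC1≡n)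
open import Data.Nat.DivMod using (_%_; _/_; m≡m%n+[m/n]*n; m*n%n≡0)
open import Data.Nat.ListAction.Properties using (sum-↭; sum-++)
import Data.Nat.Properties as NP
import Data.Nat.Tactic.RingSolver as ℕ-Ring
open import Data.Product using (_×_; _,_; proj₁; proj₂; ∃)
open import Data.Sum using (_⊎_; inj₁; inj₂)
open import Data.Unit using (tt)
open import Function using (_∘_)
open import Function.Bundles using (_⇔_; mk⇔; Equivalence)
open import Level using (0ℓ)
open import Relation.Binary.Bundles using (Setoid)
open import Relation.Binary.PropositionalEquality using (_≡_; _≢_; refl; sym; trans; cong; cong₂; subst; subst₂; module ≡-Reasoning)
import Relation.Binary.Reasoning.Setoid as SetoidR
open import Relation.Nullary using (¬_; yes; no)

open Algebra.Properties.CommutativeSemigroup NP.+-commutativeSemigroup using () renaming (interchange to +-interchange)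
open Algebra.Properties.CommutativeSemigroup ZP.+-commutativeSemigroup using () renaming (interchange to +ᶻ-interchange)


sumTo : ℕ → (ℕ → ℤ) → ℤ
sumTo L F = sumℤ (map F (upTo L))

sumℤ-++ : ∀ xs ys → sumℤ (xs ++ ys) ≡ sumℤ xs +ᶻ sumℤ ys
sumℤ-++ [] ys = sym (ZP.+-identityˡ _)
sumℤ-++ (x ∷ xs) ys rewrite sumℤ-++ xs ys = sym (ZP.+-assoc x _ _)

sumTo-head : ∀ L F → sumTo (suc L) F ≡ F 0 +ᶻ sumTo L (F ∘ suc)
sumTo-head L F = cong (λ z → F 0 +ᶻ sumℤ z)
  (trans (cong (map F) (sym (LP.map-upTo suc L))) (sym (LP.map-∘ (upTo L))))

sumTo-snoc : ∀ L F → sumTo (suc L) F ≡ sumTo L F +ᶻ F L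
sumTo-snoc L F = begin
  sumℤ (map F (upTo (suc L))) ≡⟨ cong (λ z → sumℤ (map F z)) (sym (LP.upTo-∷ʳ L)) ⟩
  sumℤ (map F (upTo L ++ L ∷ [])) ≡⟨ cong sumℤ (LP.map-++ F (upTo L) (L ∷ [])) ⟩
  sumℤ (map F (upTo L) ++ F L ∷ []) ≡⟨ sumℤ-++ (map F (upTo L)) (F L ∷ []) ⟩
  sumTo L F +ᶻ (F L +ᶻ + 0) ≡⟨ cong (sumTo L F +ᶻ_) (ZP.+-identityʳ (F L)) ⟩
  sumTo L F +ᶻ F L ∎
  where open ≡-Reasoning

sumTo-cong : ∀ L F G → (∀ k → k < L → F k ≡ G k) → sumTo L F ≡ sumTo L G
sumTo-cong zero F G eq = refl
sumTo-cong (suc L) F G eq = begin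
  sumTo (suc L) F ≡⟨ sumTo-snoc L F ⟩
  sumTo L F +ᶻ F L ≡⟨ cong₂ _+ᶻ_ (sumTo-cong L F G (λ k k<L → eq k (NP.m<n⇒m<1+n k<L))) (eq L (NP.n<1+n L)) ⟩
  sumTo L G +ᶻ G L ≡⟨ sym (sumTo-snoc L G) ⟩
  sumTo (suc L) G ∎
  where open ≡-Reasoning

sumTo-zero : ∀ L F → (∀ k → k < L → F k ≡ + 0) → sumTo L F ≡ + 0
sumTo-zero zero F eq = refl
sumTo-zero (suc L) F eq = begin
  sumTo (suc L) F ≡⟨ sumTo-snoc L F ⟩
  sumTo L F +ᶻ F L ≡⟨ cong₂ _+ᶻ_ (sumTo-zero L F (λ k k<L → eq k (NP.m<n⇒m<1+n k<L))) (eq L (NP.n<1+n L)) ⟩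
  + 0 ∎
  where open ≡-Reasoning

sumTo-+ : ∀ L F G → sumTo L (λ k → F k +ᶻ G k) ≡ sumTo L F +ᶻ sumTo L G
sumTo-+ zero F G = refl
sumTo-+ (suc L) F G = begin
  sumTo (suc L) (λ k → F k +ᶻ G k) ≡⟨ sumTo-snoc L _ ⟩
  sumTo L (λ k → F k +ᶻ G k) +ᶻ (F L +ᶻ G L) ≡⟨ cong (_+ᶻ (F L +ᶻ G L)) (sumTo-+ L F G) ⟩
  (sumTo L F +ᶻ sumTo L G) +ᶻ (F L +ᶻ G L) ≡⟨ +ᶻ-interchange (sumTo L F) (sumTo L G) (F L) (G L) ⟩
  (sumTo L F +ᶻ F L) +ᶻ (sumTo L G +ᶻ G L) ≡⟨ sym (cong₂ _+ᶻ_ (sumTo-snoc L F) (sumTo-snoc L G)) ⟩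
  sumTo (suc L) F +ᶻ sumTo (suc L) G ∎
  where open ≡-Reasoning

sumTo-* : ∀ L c F → sumTo L (λ k → c *ᶻ F k) ≡ c *ᶻ sumTo L F
sumTo-* zero c F = sym (ZP.*-zeroʳ c)
sumTo-* (suc L) c F = begin
  sumTo (suc L) (λ k → c *ᶻ F k) ≡⟨ sumTo-snoc L _ ⟩
  sumTo L (λ k → c *ᶻ F k) +ᶻ c *ᶻ F L ≡⟨ cong (_+ᶻ c *ᶻ F L) (sumTo-* L c F) ⟩
  c *ᶻ sumTo L F +ᶻ c *ᶻ F L ≡⟨ sym (ZP.*-distribˡ-+ c (sumTo L F) (F L)) ⟩
  c *ᶻ (sumTo L F +ᶻ F L) ≡⟨ cong (c *ᶻ_) (sym (sumTo-snoc L F)) ⟩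
  c *ᶻ sumTo (suc L) F ∎
  where open ≡-Reasoning

ι-true : ∀ {b} → T b → ι b ≡ + 1
ι-true {true} _ = refl

ι-false : ∀ {b} → ¬ T b → ι b ≡ + 0
ι-false {true} nb = ⊥-elim (nb tt)
ι-false {false} _ = refl

sumTo-indicator-unique : ∀ L (p : ℕ → Bool) (h : ℕ → ℤ) c →
  (∀ j → j < L → T (p j) → j ≡ c) → T (p c) → c < L →
  sumTo L (λ j → ι (p j) *ᶻ h j) ≡ h c
sumTo-indicator-unique zero p h c u pc ()
sumTo-indicator-unique (suc L) p h c u pc c<L with c ≟ L
... | yes refl = begin
  sumTo (suc L) (λ j → ι (p j) *ᶻ h j) ≡⟨ sumTo-snoc L _ ⟩
  sumTo L (λ j → ι (p j) *ᶻ h j) +ᶻ ι (p c) *ᶻ h c ≡⟨ cong₂ _+ᶻ_ (sumTo-zero L (λ j → ι (p j) *ᶻ h j) (λ k k<L → z k k<L)) (cong (_*ᶻ h c) (ι-true pc)) ⟩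
  + 0 +ᶻ + 1 *ᶻ h c ≡⟨ ZP.+-identityˡ _ ⟩
  + 1 *ᶻ h c ≡⟨ ZP.*-identityˡ (h c) ⟩
  h c ∎
  where
  open ≡-Reasoning
  z : ∀ k → k < c → ι (p k) *ᶻ h k ≡ + 0
  z k k<c with p k in eq
  ... | true = ⊥-elim (NP.<-irrefl (u k (NP.m<n⇒m<1+n k<c) (subst T (sym eq) tt)) k<c)
  ... | false = refl
... | no c≢L = begin
  sumTo (suc L) (λ j → ι (p j) *ᶻ h j) ≡⟨ sumTo-snoc L _ ⟩
  sumTo L (λ j → ι (p j) *ᶻ h j) +ᶻ ι (p L) *ᶻ h L ≡⟨ cong₂ _+ᶻ_ (sumTo-indicator-unique L p h c (λ j j<L → u j (NP.m<n⇒m<1+n j<L)) pc c<L') zL ⟩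
  h c +ᶻ + 0 ≡⟨ ZP.+-identityʳ _ ⟩
  h c ∎
  where
  open ≡-Reasoning
  c<L' : c < L
  c<L' = NP.≤∧≢⇒< (NP.≤-pred c<L) c≢L
  zL : ι (p L) *ᶻ h L ≡ + 0
  zL with p L in eq
  ... | true = ⊥-elim (c≢L (sym (u L (NP.n<1+n L) (subst T (sym eq) tt))))
  ... | false = refl

sumTo-indicator-none : ∀ L (p : ℕ → Bool) (h : ℕ → ℤ) →
  (∀ j → j < L → ¬ T (p j)) → sumTo L (λ j → ι (p j) *ᶻ h j) ≡ + 0
sumTo-indicator-none L p h n = sumTo-zero L (λ j → ι (p j) *ᶻ h j) (λ k k<L → cong (_*ᶻ h k) (ι-false (n k k<L)))

sumℤ-cong∈ : ∀ {A : Set} (f g : A → ℤ) xs → (∀ x → x ∈ xs → f x ≡ g x) → sumℤ (map f xs) ≡ sumℤ (map g xs)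
sumℤ-cong∈ f g [] _ = refl
sumℤ-cong∈ f g (x ∷ xs) e = cong₂ _+ᶻ_ (e x (here refl)) (sumℤ-cong∈ f g xs (λ y p → e y (there p)))

+-sumℕ : ∀ {A : Set} (f : A → ℕ) xs → + sumℕ (map f xs) ≡ sumℤ (map (λ x → + f x) xs)
+-sumℕ f [] = refl
+-sumℕ f (x ∷ xs) = trans (ZP.pos-+ (f x) _) (cong (+ f x +ᶻ_) (+-sumℕ f xs))

sumℕ-concatMap : ∀ {A B : Set} (h : B → ℕ) (f : A → List B) xs →
  sumℕ (map h (concatMap f xs)) ≡ sumℕ (map (λ x → sumℕ (map h (f x))) xs)
sumℕ-concatMap h f [] = refl
sumℕ-concatMap h f (x ∷ xs) = trans (cong sumℕ (LP.map-++ h (f x) (concatMap f xs)))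
  (trans (sum-++ (map h (f x)) _) (cong (λ z → sumℕ (map h (f x)) + z) (sumℕ-concatMap h f xs)))

sumℕ-cong∈ : ∀ {A : Set} (f g : A → ℕ) xs → (∀ x → x ∈ xs → f x ≡ g x) → sumℕ (map f xs) ≡ sumℕ (map g xs)
sumℕ-cong∈ f g [] _ = refl
sumℕ-cong∈ f g (x ∷ xs) e = cong₂ _+_ (e x (here refl)) (sumℕ-cong∈ f g xs (λ y p → e y (there p)))

sumℕ-zeros : ∀ {A : Set} (f : A → ℕ) xs → (∀ x → x ∈ xs → f x ≡ 0) → sumℕ (map f xs) ≡ 0
sumℕ-zeros f xs z = trans (sumℕ-cong∈ f (λ _ → 0) xs z) (go xs)
  where
  go : ∀ xs → sumℕ (map (λ _ → 0) xs) ≡ 0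
  go [] = refl
  go (_ ∷ xs) = go xs

sumℕ-*ʳ : ∀ {A : Set} (f : A → ℕ) c xs → sumℕ (map (λ x → f x * c) xs) ≡ sumℕ (map f xs) * c
sumℕ-*ʳ f c [] = refl
sumℕ-*ʳ f c (x ∷ xs) = trans (cong (λ z → f x * c + z) (sumℕ-*ʳ f c xs)) (sym (NP.*-distribʳ-+ c (f x) _))

sumℕ-*ˡ : ∀ {A : Set} (f : A → ℕ) c xs → sumℕ (map (λ x → c * f x) xs) ≡ c * sumℕ (map f xs)
sumℕ-*ˡ f c xs = trans (sumℕ-cong∈ (λ x → c * f x) (λ x → f x * c) xs (λ x _ → NP.*-comm c (f x)))
  (trans (sumℕ-*ʳ f c xs) (NP.*-comm _ c))

sumℕ-+ : ∀ {A : Set} (f g : A → ℕ) xs → sumℕ (map (λ x → f x + g x) xs) ≡ sumℕ (map f xs) + sumℕ (map g xs)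
sumℕ-+ f g [] = refl
sumℕ-+ f g (x ∷ xs) rewrite sumℕ-+ f g xs =
  +-interchange (f x) (g x) (sumℕ (map f xs)) (sumℕ (map g xs))

sumℕ-swap : ∀ {A B : Set} (h : A → B → ℕ) xs ys →
  sumℕ (map (λ x → sumℕ (map (h x) ys)) xs) ≡ sumℕ (map (λ y → sumℕ (map (λ x → h x y) xs)) ys)
sumℕ-swap h [] ys = sym (sumℕ-zeros (λ _ → 0) ys (λ _ _ → refl))
sumℕ-swap h (x ∷ xs) ys = trans (cong (λ z → sumℕ (map (h x) ys) + z) (sumℕ-swap h xs ys))
  (sym (sumℕ-+ (h x) (λ y → sumℕ (map (λ x' → h x' y) xs)) ys))

toℕ : Bool → ℕ
toℕ true = 1
toℕ false = 0

toℕ-∧ : ∀ a b → toℕ (a ∧ b) ≡ toℕ a * toℕ b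
toℕ-∧ true b = sym (NP.+-identityʳ (toℕ b))
toℕ-∧ false b = refl

T⇒≡ : ∀ {b} → T b → b ≡ true
T⇒≡ = Equivalence.to BP.T-≡

¬T⇒≡ : ∀ {b} → ¬ T b → b ≡ false
¬T⇒≡ {true} n = ⊥-elim (n tt)
¬T⇒≡ {false} _ = refl

≡ᵇ-refl : ∀ n → (n ≡ᵇ n) ≡ true
≡ᵇ-refl n = T⇒≡ (NP.≡⇒≡ᵇ n n refl)

≡ᵇ-≢ : ∀ m n → m ≢ n → (m ≡ᵇ n) ≡ false
≡ᵇ-≢ m n ne = ¬T⇒≡ (λ t → ne (NP.≡ᵇ⇒≡ m n t))


∈-concatMap⁻′ : ∀ {A B : Set} (f : A → List B) xs {y} → y ∈ concatMap f xs → ∃ λ x → x ∈ xs × y ∈ f x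
∈-concatMap⁻′ f xs p = find (MP.∈-concatMap⁻ f {xs = xs} p)

∈-concatMap⁺′ : ∀ {A B : Set} (f : A → List B) {xs x y} → x ∈ xs → y ∈ f x → y ∈ concatMap f xs
∈-concatMap⁺′ f {xs} x∈ y∈ = MP.∈-concatMap⁺ f {xs = xs} (lose x∈ y∈)

Unique-concatMap : ∀ {A B : Set} (f : A → List B) (tag : B → A) xs → Unique xs → (∀ x → x ∈ xs → Unique (f x)) →
  (∀ x → x ∈ xs → ∀ y → y ∈ f x → tag y ≡ x) → Unique (concatMap f xs)
Unique-concatMap f tag [] _ _ _ = []
Unique-concatMap f tag (x ∷ xs) (x∉ ∷ u) uf tg =
  UP.++⁺ (uf x (here refl)) (Unique-concatMap f tag xs u (λ x' p → uf x' (there p)) (λ x' p → tg x' (there p))) disj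
  where
  disj : Disjoint (f x) (concatMap f xs)
  disj (y∈ , y∈r) with ∈-concatMap⁻′ f xs y∈r
  ... | x' , x'∈ , y∈' = All.lookup x∉ x'∈ (trans (sym (tg x (here refl) _ y∈)) (tg x' (there x'∈) _ y∈'))

remove : ℕ → List ℕ → List ℕ
remove y [] = []
remove y (x ∷ xs) = if x ≡ᵇ y then remove y xs else x ∷ remove y xs

∈-remove⁻ : ∀ y xs {x} → x ∈ remove y xs → x ∈ xs × x ≢ y
∈-remove⁻ y (z ∷ xs) p with z ≡ᵇ y in e
... | true = let (q , ne) = ∈-remove⁻ y xs p in there q , ne
∈-remove⁻ y (z ∷ xs) (here refl) | false = here refl , λ eq → subst T e (NP.≡⇒≡ᵇ z y eq)
∈-remove⁻ y (z ∷ xs) (there p) | false = let (q , ne) = ∈-remove⁻ y xs p in there q , ne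

All-remove : ∀ {P : ℕ → Set} y xs → All P xs → All P (remove y xs)
All-remove y [] [] = []
All-remove y (x ∷ xs) (px ∷ al) with x ≡ᵇ y
... | true = All-remove y xs al
... | false = px ∷ All-remove y xs al

remove-unique : ∀ y xs → Unique xs → Unique (remove y xs)
remove-unique y [] _ = []
remove-unique y (x ∷ xs) (x∉ ∷ u) with x ≡ᵇ y
... | true = remove-unique y xs u
... | false = All-remove y xs x∉ ∷ remove-unique y xs u

remove-length-none : ∀ y xs → All (λ x → x ≢ y) xs → length (remove y xs) ≡ length xs
remove-length-none y [] _ = refl
remove-length-none y (x ∷ xs) (ne ∷ al) rewrite ≡ᵇ-≢ x y ne = cong suc (remove-length-none y xs al)

remove-length : ∀ y xs → Unique xs → length xs ≤ suc (length (remove y xs))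
remove-length y [] _ = z≤n
remove-length y (x ∷ xs) (x∉ ∷ u) with x ≟ y
... | yes refl rewrite ≡ᵇ-refl x =
  s≤s (NP.≤-reflexive (sym (remove-length-none x xs (All.map (λ ne e → ne (sym e)) x∉))))
... | no ne rewrite ≡ᵇ-≢ x y ne = s≤s (remove-length y xs u)

Unique-⊆-length≤ : ∀ xs ys → Unique xs → (∀ x → x ∈ xs → x ∈ ys) → length xs ≤ length ys
Unique-⊆-length≤ [] ys _ _ = z≤n
Unique-⊆-length≤ (x ∷ xs) [] _ sub with sub x (here refl)
... | ()
Unique-⊆-length≤ xs (y ∷ ys) u sub = NP.≤-trans (remove-length y xs u) (s≤s (Unique-⊆-length≤ (remove y xs) ys (remove-unique y xs u) sub'))
  where
  sub' : ∀ x → x ∈ remove y xs → x ∈ ys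
  sub' x p with ∈-remove⁻ y xs p
  ... | q , ne with sub x q
  ... | here e = ⊥-elim (ne e)
  ... | there q' = q'


infix 4 _≈_
_≈_ : Series → Series → Set
f ≈ g = ∀ n → f n ≡ g n

≈-trans : ∀ {f g h} → f ≈ g → g ≈ h → f ≈ h
≈-trans p q n = trans (p n) (q n)

≈-sym : ∀ {f g} → f ≈ g → g ≈ f
≈-sym p n = sym (p n)

tailS : Series → Series
tailS f k = f (suc k)

zeroS : Series
zeroS _ = + 0

⊛-coeff-zero : ∀ f g → (f ⊛ g) 0 ≡ f 0 *ᶻ g 0
⊛-coeff-zero f g = ZP.+-identityʳ _

⊛-coeff-sucˡ : ∀ f g n → (f ⊛ g) (suc n) ≡ f 0 *ᶻ g (suc n) +ᶻ (tailS f ⊛ g) n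
⊛-coeff-sucˡ f g n = sumTo-head (suc n) (λ k → f k *ᶻ g (suc n ∸ k))

⊛-coeff-sucʳ : ∀ f g n → (f ⊛ g) (suc n) ≡ (f ⊛ tailS g) n +ᶻ f (suc n) *ᶻ g 0
⊛-coeff-sucʳ f g n = begin
  (f ⊛ g) (suc n) ≡⟨ sumTo-snoc (suc n) (λ k → f k *ᶻ g (suc n ∸ k)) ⟩
  sumTo (suc n) (λ k → f k *ᶻ g (suc n ∸ k)) +ᶻ f (suc n) *ᶻ g (suc n ∸ suc n)
    ≡⟨ cong₂ _+ᶻ_ (sumTo-cong (suc n) (λ k → f k *ᶻ g (suc n ∸ k)) (λ k → f k *ᶻ g (suc (n ∸ k))) (λ k k<sn → cong (λ z → f k *ᶻ g z) (NP.+-∸-assoc 1 (NP.≤-pred k<sn))))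
                  (cong (λ z → f (suc n) *ᶻ g z) (NP.n∸n≡0 n)) ⟩
  (f ⊛ tailS g) n +ᶻ f (suc n) *ᶻ g 0 ∎
  where open ≡-Reasoning

⊛-cong : ∀ f f' g g' → f ≈ f' → g ≈ g' → f ⊛ g ≈ f' ⊛ g'
⊛-cong f f' g g' p q n = sumTo-cong (suc n) (λ k → f k *ᶻ g (n ∸ k)) (λ k → f' k *ᶻ g' (n ∸ k)) (λ k _ → cong₂ _*ᶻ_ (p k) (q (n ∸ k)))

⊛-zeroˡ : ∀ g → zeroS ⊛ g ≈ zeroS
⊛-zeroˡ g n = sumTo-zero (suc n) (λ k → + 0 *ᶻ g (n ∸ k)) (λ k _ → refl)

⊛-distribʳ : ∀ f g h → (f ⊕ g) ⊛ h ≈ (f ⊛ h) ⊕ (g ⊛ h)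
⊛-distribʳ f g h n = trans (sumTo-cong (suc n) (λ k → (f k +ᶻ g k) *ᶻ h (n ∸ k)) (λ k → f k *ᶻ h (n ∸ k) +ᶻ g k *ᶻ h (n ∸ k)) (λ k _ → ZP.*-distribʳ-+ (h (n ∸ k)) (f k) (g k)))
  (sumTo-+ (suc n) (λ k → f k *ᶻ h (n ∸ k)) (λ k → g k *ᶻ h (n ∸ k)))

⊛-scaleˡ : ∀ c f h → scale c f ⊛ h ≈ scale c (f ⊛ h)
⊛-scaleˡ c f h n = trans (sumTo-cong (suc n) (λ k → c *ᶻ f k *ᶻ h (n ∸ k)) (λ k → c *ᶻ (f k *ᶻ h (n ∸ k))) (λ k _ → ZP.*-assoc c (f k) (h (n ∸ k)))) (sumTo-* (suc n) c (λ k → f k *ᶻ h (n ∸ k)))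

⊛-comm : ∀ f g → f ⊛ g ≈ g ⊛ f
⊛-comm f g zero = trans (⊛-coeff-zero f g) (trans (ZP.*-comm (f 0) (g 0)) (sym (⊛-coeff-zero g f)))
⊛-comm f g (suc n) = begin
  (f ⊛ g) (suc n) ≡⟨ ⊛-coeff-sucˡ f g n ⟩
  f 0 *ᶻ g (suc n) +ᶻ (tailS f ⊛ g) n ≡⟨ cong₂ _+ᶻ_ (ZP.*-comm (f 0) _) (⊛-comm (tailS f) g n) ⟩
  g (suc n) *ᶻ f 0 +ᶻ (g ⊛ tailS f) n ≡⟨ ZP.+-comm (g (suc n) *ᶻ f 0) ((g ⊛ tailS f) n) ⟩
  (g ⊛ tailS f) n +ᶻ g (suc n) *ᶻ f 0 ≡⟨ sym (⊛-coeff-sucʳ g f n) ⟩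
  (g ⊛ f) (suc n) ∎
  where open ≡-Reasoning

⊛-identityˡ : ∀ f → one ⊛ f ≈ f
⊛-identityˡ f zero = trans (⊛-coeff-zero one f) (ZP.*-identityˡ (f 0))
⊛-identityˡ f (suc n) = begin
  (one ⊛ f) (suc n) ≡⟨ ⊛-coeff-sucˡ one f n ⟩
  + 1 *ᶻ f (suc n) +ᶻ (zeroS ⊛ f) n ≡⟨ cong₂ _+ᶻ_ (ZP.*-identityˡ (f (suc n))) (⊛-zeroˡ f n) ⟩
  f (suc n) +ᶻ + 0 ≡⟨ ZP.+-identityʳ _ ⟩
  f (suc n) ∎
  where open ≡-Reasoning

⊛-identityʳ : ∀ f → f ⊛ one ≈ f
⊛-identityʳ f = ≈-trans (⊛-comm f one) (⊛-identityˡ f)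

tailS-⊛ : ∀ f g → tailS (f ⊛ g) ≈ scale (f 0) (tailS g) ⊕ (tailS f ⊛ g)
tailS-⊛ f g n = ⊛-coeff-sucˡ f g n

⊛-assoc : ∀ f g h → (f ⊛ g) ⊛ h ≈ f ⊛ (g ⊛ h)
⊛-assoc f g h zero = begin
  ((f ⊛ g) ⊛ h) 0 ≡⟨ ⊛-coeff-zero (f ⊛ g) h ⟩
  (f ⊛ g) 0 *ᶻ h 0 ≡⟨ cong (_*ᶻ h 0) (⊛-coeff-zero f g) ⟩
  f 0 *ᶻ g 0 *ᶻ h 0 ≡⟨ ZP.*-assoc (f 0) _ _ ⟩
  f 0 *ᶻ (g 0 *ᶻ h 0) ≡⟨ cong (f 0 *ᶻ_) (sym (⊛-coeff-zero g h)) ⟩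
  f 0 *ᶻ (g ⊛ h) 0 ≡⟨ sym (⊛-coeff-zero f (g ⊛ h)) ⟩
  (f ⊛ (g ⊛ h)) 0 ∎
  where open ≡-Reasoning
⊛-assoc f g h (suc n) = begin
  ((f ⊛ g) ⊛ h) (suc n) ≡⟨ ⊛-coeff-sucˡ (f ⊛ g) h n ⟩
  (f ⊛ g) 0 *ᶻ h (suc n) +ᶻ (tailS (f ⊛ g) ⊛ h) n
    ≡⟨ cong₂ _+ᶻ_ (cong (_*ᶻ h (suc n)) (⊛-coeff-zero f g)) (⊛-cong _ _ h h (tailS-⊛ f g) (λ _ → refl) n) ⟩
  f 0 *ᶻ g 0 *ᶻ h (suc n) +ᶻ ((scale (f 0) (tailS g) ⊕ (tailS f ⊛ g)) ⊛ h) n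
    ≡⟨ cong (f 0 *ᶻ g 0 *ᶻ h (suc n) +ᶻ_) (⊛-distribʳ (scale (f 0) (tailS g)) (tailS f ⊛ g) h n) ⟩
  f 0 *ᶻ g 0 *ᶻ h (suc n) +ᶻ ((scale (f 0) (tailS g) ⊛ h) n +ᶻ ((tailS f ⊛ g) ⊛ h) n)
    ≡⟨ cong (λ z → f 0 *ᶻ g 0 *ᶻ h (suc n) +ᶻ (z +ᶻ ((tailS f ⊛ g) ⊛ h) n)) (⊛-scaleˡ (f 0) (tailS g) h n) ⟩
  f 0 *ᶻ g 0 *ᶻ h (suc n) +ᶻ (f 0 *ᶻ (tailS g ⊛ h) n +ᶻ ((tailS f ⊛ g) ⊛ h) n)
    ≡⟨ cong (λ z → f 0 *ᶻ g 0 *ᶻ h (suc n) +ᶻ (f 0 *ᶻ (tailS g ⊛ h) n +ᶻ z)) (⊛-assoc (tailS f) g h n) ⟩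
  f 0 *ᶻ g 0 *ᶻ h (suc n) +ᶻ (f 0 *ᶻ (tailS g ⊛ h) n +ᶻ (tailS f ⊛ (g ⊛ h)) n)
    ≡⟨ regroup (f 0) (g 0) (h (suc n)) ((tailS g ⊛ h) n) ((tailS f ⊛ (g ⊛ h)) n) ⟩
  f 0 *ᶻ (g 0 *ᶻ h (suc n) +ᶻ (tailS g ⊛ h) n) +ᶻ (tailS f ⊛ (g ⊛ h)) n
    ≡⟨ cong (λ z → f 0 *ᶻ z +ᶻ (tailS f ⊛ (g ⊛ h)) n) (sym (⊛-coeff-sucˡ g h n)) ⟩
  f 0 *ᶻ (g ⊛ h) (suc n) +ᶻ (tailS f ⊛ (g ⊛ h)) n ≡⟨ sym (⊛-coeff-sucˡ f (g ⊛ h) n) ⟩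
  (f ⊛ (g ⊛ h)) (suc n) ∎
  where
  open ≡-Reasoning
  regroup : ∀ a b c d e → a *ᶻ b *ᶻ c +ᶻ (a *ᶻ d +ᶻ e) ≡ a *ᶻ (b *ᶻ c +ᶻ d) +ᶻ e
  regroup = ℤ-Ring.solve-∀

≈-setoid : Setoid _ _
≈-setoid = record { Carrier = Series ; _≈_ = _≈_ ; isEquivalence = record { refl = λ _ → refl ; sym = ≈-sym ; trans = ≈-trans } }

module ≈R = SetoidR ≈-setoid

≈-refl : ∀ {f} → f ≈ f
≈-refl _ = refl

⊛-congˡ : ∀ {f f'} g → f ≈ f' → f ⊛ g ≈ f' ⊛ g
⊛-congˡ {f} {f'} g p = ⊛-cong f f' g g p ≈-refl

⊛-congʳ : ∀ f {g g'} → g ≈ g' → f ⊛ g ≈ f ⊛ g'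
⊛-congʳ f {g} {g'} p = ⊛-cong f f g g' ≈-refl p

⊛-distribˡ : ∀ f g h → f ⊛ (g ⊕ h) ≈ (f ⊛ g) ⊕ (f ⊛ h)
⊛-distribˡ f g h n = trans (⊛-comm f (g ⊕ h) n) (trans (⊛-distribʳ g h f n)
  (cong₂ _+ᶻ_ (⊛-comm g f n) (⊛-comm h f n)))

⊛-scaleʳ : ∀ c f h → f ⊛ scale c h ≈ scale c (f ⊛ h)
⊛-scaleʳ c f h n = trans (⊛-comm f (scale c h) n) (trans (⊛-scaleˡ c h f n) (cong (c *ᶻ_) (⊛-comm h f n)))

⊛-zeroʳ : ∀ f → f ⊛ zeroS ≈ zeroS
⊛-zeroʳ f = ≈-trans (⊛-comm f zeroS) (⊛-zeroˡ f)

⊛-commutativeSemigroup : CommutativeSemigroup 0ℓ 0ℓ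
⊛-commutativeSemigroup = record
  { Carrier = Series
  ; _≈_ = _≈_
  ; _∙_ = _⊛_
  ; isCommutativeSemigroup = record
    { isSemigroup = record
      { isMagma = record { isEquivalence = Setoid.isEquivalence ≈-setoid ; ∙-cong = λ p q → ⊛-cong _ _ _ _ p q }
      ; assoc = ⊛-assoc
      }
    ; comm = ⊛-comm
    }
  }

open Algebra.Properties.CommutativeSemigroup ⊛-commutativeSemigroup using ()
  renaming (interchange to ⊛-interchange; xy∙z≈xz∙y to ⊛-swapʳ)

shift : ℕ → Series → Series
shift zero f n = f n
shift (suc e) f zero = + 0
shift (suc e) f (suc n) = shift e f n

mono-⊛ : ∀ e f → mono e ⊛ f ≈ shift e f
mono-⊛ zero f n = ⊛-identityˡ f n
mono-⊛ (suc e) f zero = trans (⊛-coeff-zero (mono (suc e)) f) (ZP.*-zeroˡ (f 0))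
mono-⊛ (suc e) f (suc n) = begin
  (mono (suc e) ⊛ f) (suc n) ≡⟨ ⊛-coeff-sucˡ (mono (suc e)) f n ⟩
  + 0 *ᶻ f (suc n) +ᶻ (mono e ⊛ f) n ≡⟨ cong₂ _+ᶻ_ (ZP.*-zeroˡ (f (suc n))) (mono-⊛ e f n) ⟩
  + 0 +ᶻ shift e f n ≡⟨ ZP.+-identityˡ _ ⟩
  shift e f n ∎
  where open ≡-Reasoning

shift-coeff-≥ : ∀ e f n → e ≤ n → shift e f n ≡ f (n ∸ e)
shift-coeff-≥ zero f n _ = refl
shift-coeff-≥ (suc e) f (suc n) (s≤s le) = shift-coeff-≥ e f n le

shift-coeff-< : ∀ e f n → n < e → shift e f n ≡ + 0
shift-coeff-< (suc e) f zero _ = refl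
shift-coeff-< (suc e) f (suc n) (s≤s lt) = shift-coeff-< e f n lt

shift-mono : ∀ x y → shift x (mono y) ≈ mono (x + y)
shift-mono zero y n = refl
shift-mono (suc x) y zero = refl
shift-mono (suc x) y (suc n) = shift-mono x y n

mono-mono : ∀ x y → mono x ⊛ mono y ≈ mono (x + y)
mono-mono x y = ≈-trans (mono-⊛ x (mono y)) (shift-mono x y)

multiple? : ∀ m n → (∃ λ t → n ≡ suc m * t) ⊎ (∀ t → n ≢ suc m * t)
multiple? m n with n % suc m in eq
... | zero = inj₁ (n / suc m , trans (m≡m%n+[m/n]*n n (suc m)) (trans (cong (_+ (n / suc m) * suc m) eq) (NP.*-comm (n / suc m) (suc m))))
... | suc r = inj₂ λ t e → contra t e
  where
  contra : ∀ t → n ≡ suc m * t → ⊥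
  contra t e with trans (sym eq) (trans (cong (_% suc m) (trans e (NP.*-comm (suc m) t))) (m*n%n≡0 t (suc m)))
  ... | ()

geomInv-coeff-multiple : ∀ c m n t → n ≡ suc m * t → geomInv c (suc m) n ≡ c ℤ.^ t
geomInv-coeff-multiple c m n t e = trans (sumTo-cong (suc n) (λ j → (c ℤ.^ j) *ᶻ ι (n ≡ᵇ suc m * j)) (λ j → ι (n ≡ᵇ suc m * j) *ᶻ (c ℤ.^ j)) (λ j _ → ZP.*-comm (c ℤ.^ j) _))
  (sumTo-indicator-unique (suc n) (λ j → n ≡ᵇ suc m * j) (λ j → c ℤ.^ j) t
    (λ j _ pj → NP.*-cancelˡ-≡ j t (suc m) (trans (sym (NP.≡ᵇ⇒≡ n _ pj)) e))
    (NP.≡⇒≡ᵇ n _ e)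
    (s≤s (subst (t ≤_) (sym e) (NP.m≤n*m t (suc m)))))

geomInv-coeff-nonmultiple : ∀ c m n → (∀ t → n ≢ suc m * t) → geomInv c (suc m) n ≡ + 0
geomInv-coeff-nonmultiple c m n miss = trans (sumTo-cong (suc n) (λ j → (c ℤ.^ j) *ᶻ ι (n ≡ᵇ suc m * j)) (λ j → ι (n ≡ᵇ suc m * j) *ᶻ (c ℤ.^ j)) (λ j _ → ZP.*-comm (c ℤ.^ j) _))
  (sumTo-indicator-none (suc n) (λ j → n ≡ᵇ suc m * j) (λ j → c ℤ.^ j) (λ j _ pj → miss j (NP.≡ᵇ⇒≡ n _ pj)))

onePlus-⊛-coeff : ∀ m f n → (onePlus m ⊛ f) n ≡ f n +ᶻ shift m f n
onePlus-⊛-coeff m f n = trans (⊛-distribʳ one (mono m) f n) (cong₂ _+ᶻ_ (⊛-identityˡ f n) (mono-⊛ m f n))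

onePlus-⊛-geomInv : ∀ m → onePlus (suc m) ⊛ geomInv ℤ.-1ℤ (suc m) ≈ one
onePlus-⊛-geomInv m n = trans (onePlus-⊛-coeff (suc m) G n) (go n (multiple? m n))
  where
  G = geomInv ℤ.-1ℤ (suc m)
  go : ∀ n → (∃ λ t → n ≡ suc m * t) ⊎ (∀ t → n ≢ suc m * t) → G n +ᶻ shift (suc m) G n ≡ one n
  go n (inj₁ (zero , e)) rewrite e | NP.*-zeroʳ m = refl
  go n (inj₁ (suc t , e)) rewrite e = begin
      G (suc m * suc t) +ᶻ shift (suc m) G (suc m * suc t)
        ≡⟨ cong₂ _+ᶻ_ (geomInv-coeff-multiple ℤ.-1ℤ m _ (suc t) refl)
                      (trans (shift-coeff-≥ (suc m) G _ (NP.m≤m*n (suc m) (suc t))) (geomInv-coeff-multiple ℤ.-1ℤ m _ t e2)) ⟩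
      ℤ.-1ℤ *ᶻ (ℤ.-1ℤ ℤ.^ t) +ᶻ ℤ.-1ℤ ℤ.^ t ≡⟨ trans (cong (_+ᶻ (ℤ.-1ℤ ℤ.^ t)) (ZP.-1*i≡-i (ℤ.-1ℤ ℤ.^ t))) (ZP.+-inverseˡ (ℤ.-1ℤ ℤ.^ t)) ⟩
      + 0 ∎
    where
    open ≡-Reasoning
    e2 : suc m * suc t ∸ suc m ≡ suc m * t
    e2 = trans (cong (_∸ suc m) (NP.*-suc (suc m) t)) (NP.m+n∸m≡n (suc m) _)
  go zero (inj₂ miss) = ⊥-elim (miss 0 (sym (NP.*-zeroʳ m)))
  go (suc n) (inj₂ miss) with suc m ≤? suc n
  ... | yes le = trans (cong₂ _+ᶻ_ (geomInv-coeff-nonmultiple ℤ.-1ℤ m (suc n) miss)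
                  (trans (shift-coeff-≥ (suc m) G (suc n) le) (geomInv-coeff-nonmultiple ℤ.-1ℤ m _ miss2))) refl
    where
    miss2 : ∀ t → suc n ∸ suc m ≢ suc m * t
    miss2 t e = miss (suc t) (trans (sym (NP.m+[n∸m]≡n le)) (trans (cong (λ z → suc m + z) e) (sym (NP.*-suc (suc m) t))))
  ... | no nle = trans (cong₂ _+ᶻ_ (geomInv-coeff-nonmultiple ℤ.-1ℤ m (suc n) miss) (shift-coeff-< (suc m) G (suc n) (NP.≰⇒> nle))) refl

prodTo : (ℕ → Series) → ℕ → Series
prodTo F zero = one
prodTo F (suc M) = F (suc M) ⊛ prodTo F M

prodTo-cong : ∀ M F G → (∀ s → s ≤ M → F s ≈ G s) → prodTo F M ≈ prodTo G M
prodTo-cong zero F G p = ≈-refl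
prodTo-cong (suc M) F G p = ⊛-cong _ _ _ _ (p (suc M) NP.≤-refl) (prodTo-cong M F G (λ s s≤M → p s (NP.m≤n⇒m≤1+n s≤M)))

prodTo-⊛ : ∀ M F G → prodTo (λ s → F s ⊛ G s) M ≈ prodTo F M ⊛ prodTo G M
prodTo-⊛ zero F G = ≈-sym (⊛-identityˡ one)
prodTo-⊛ (suc M) F G = begin
  (F (suc M) ⊛ G (suc M)) ⊛ prodTo (λ s → F s ⊛ G s) M ≈⟨ ⊛-congʳ (F (suc M) ⊛ G (suc M)) (prodTo-⊛ M F G) ⟩
  (F (suc M) ⊛ G (suc M)) ⊛ (prodTo F M ⊛ prodTo G M) ≈⟨ ⊛-interchange (F (suc M)) (G (suc M)) (prodTo F M) (prodTo G M) ⟩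
  (F (suc M) ⊛ prodTo F M) ⊛ (G (suc M) ⊛ prodTo G M) ∎
  where open ≈R

prodTo-update : ∀ M F G X s0 → 1 ≤ s0 → s0 ≤ M → (∀ s → s ≢ s0 → G s ≈ F s) → G s0 ≈ F s0 ⊛ X →
  prodTo G M ≈ prodTo F M ⊛ X
prodTo-update zero F G X s0 1≤s0 s0≤0 _ _ with NP.≤-trans 1≤s0 s0≤0
... | ()
prodTo-update (suc M) F G X s0 1≤s0 s0≤M diff same with s0 ≟ suc M
... | yes refl = begin
  G (suc M) ⊛ prodTo G M ≈⟨ ⊛-cong _ _ _ _ same (prodTo-cong M G F (λ s s≤M → diff s (λ e → NP.<-irrefl e (s≤s s≤M)))) ⟩
  (F (suc M) ⊛ X) ⊛ prodTo F M ≈⟨ ⊛-swapʳ (F (suc M)) X (prodTo F M) ⟩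
  (F (suc M) ⊛ prodTo F M) ⊛ X ∎
  where open ≈R
... | no ne = begin
  G (suc M) ⊛ prodTo G M ≈⟨ ⊛-cong _ _ _ _ (diff (suc M) (λ e → ne (sym e))) (prodTo-update M F G X s0 1≤s0 (NP.≤-pred (NP.≤∧≢⇒< s0≤M ne)) diff same) ⟩
  F (suc M) ⊛ (prodTo F M ⊛ X) ≈⟨ ≈-sym (⊛-assoc (F (suc M)) (prodTo F M) X) ⟩
  (F (suc M) ⊛ prodTo F M) ⊛ X ∎
  where open ≈R

prodS-snoc : ∀ xs x → prodS (xs ++ x ∷ []) ≈ prodS xs ⊛ x
prodS-snoc [] x = ≈-trans (⊛-comm x one) ≈-refl
prodS-snoc (y ∷ ys) x = begin
  y ⊛ prodS (ys ++ x ∷ []) ≈⟨ ⊛-congʳ y (prodS-snoc ys x) ⟩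
  y ⊛ (prodS ys ⊛ x) ≈⟨ ≈-sym (⊛-assoc y _ x) ⟩
  (y ⊛ prodS ys) ⊛ x ∎
  where open ≈R

map-upTo-suc : ∀ {A : Set} (f : ℕ → A) M → map f (upTo (suc M)) ≡ map f (upTo M) ++ f M ∷ []
map-upTo-suc f M = trans (cong (map f) (sym (LP.upTo-∷ʳ M))) (LP.map-++ f (upTo M) (M ∷ []))

prodS-upTo : ∀ (F : ℕ → Series) M → prodS (map F (upTo (suc M))) ≈ prodS (map F (upTo M)) ⊛ F M
prodS-upTo F M n = trans (cong (λ z → prodS z n) (map-upTo-suc F M)) (prodS-snoc (map F (upTo M)) (F M) n)

range1-suc : ∀ M → range1 (suc M) ≡ range1 M ++ suc M ∷ []
range1-suc M = map-upTo-suc suc M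

prodS-range1 : ∀ F M → prodS (map F (range1 M)) ≈ prodTo F M
prodS-range1 F zero = ≈-refl
prodS-range1 F (suc M) = begin
  prodS (map F (range1 (suc M))) ≈⟨ (λ n → cong (λ z → prodS (map F z) n) (range1-suc M)) ⟩
  prodS (map F (range1 M ++ suc M ∷ [])) ≈⟨ (λ n → cong (λ z → prodS z n) (LP.map-++ F (range1 M) (suc M ∷ []))) ⟩
  prodS (map F (range1 M) ++ F (suc M) ∷ []) ≈⟨ prodS-snoc (map F (range1 M)) (F (suc M)) ⟩
  prodS (map F (range1 M)) ⊛ F (suc M) ≈⟨ ⊛-congˡ (F (suc M)) (prodS-range1 F M) ⟩
  prodTo F M ⊛ F (suc M) ≈⟨ ⊛-comm (prodTo F M) (F (suc M)) ⟩
  prodTo F (suc M) ∎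
  where open ≈R

invPoch-suc : ∀ A a k → invPoch A a (suc k) ≈ invPoch A a k ⊛ geomInv ℤ.-1ℤ (a + k * A)
invPoch-suc A a k = prodS-upTo (λ j → geomInv ℤ.-1ℤ (a + j * A)) k

⊛-sumS : ∀ f gs n → (f ⊛ sumS gs) n ≡ sumℤ (map (λ g → (f ⊛ g) n) gs)
⊛-sumS f [] n = ⊛-zeroʳ f n
⊛-sumS f (g ∷ gs) n = trans (⊛-distribˡ f g (sumS gs) n) (cong ((f ⊛ g) n +ᶻ_) (⊛-sumS f gs n))

overGF-prodTo : ∀ N → overGF N ≈ prodTo (λ s → onePlus s ⊛ geomInv (+ 1) s) N
overGF-prodTo N = ≈-trans (⊛-cong _ _ _ _ (prodS-range1 onePlus N) (prodS-range1 (geomInv (+ 1)) N))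
  (≈-sym (prodTo-⊛ N onePlus (geomInv (+ 1))))

summand : ℕ → ℕ → ℕ → ℕ → Series
summand r A a k = mono (r * (A * (k C 2) + k * a)) ⊛ invPoch A a k

rhsTrunc-coeff : ∀ r A a N n → rhsTrunc r A a N n ≡
  + a *ᶻ overGF N n +ᶻ + A *ᶻ sumℤ (map (λ k → (overGF N ⊛ summand r A a k) n) (range1 N))
rhsTrunc-coeff r A a N n = begin
  rhsTrunc r A a N n ≡⟨ ⊛-distribˡ O (scale (+ a) one) (scale (+ A) S) n ⟩
  (O ⊛ scale (+ a) one) n +ᶻ (O ⊛ scale (+ A) S) n ≡⟨ cong₂ _+ᶻ_ (⊛-scaleʳ (+ a) O one n) (⊛-scaleʳ (+ A) O S n) ⟩
  + a *ᶻ (O ⊛ one) n +ᶻ + A *ᶻ (O ⊛ S) n ≡⟨ cong₂ _+ᶻ_ (cong (+ a *ᶻ_) (⊛-identityʳ O n)) (cong (+ A *ᶻ_) (⊛-sumS O (map (summand r A a) (range1 N)) n)) ⟩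
  + a *ᶻ O n +ᶻ + A *ᶻ sumℤ (map (λ g → (O ⊛ g) n) (map (summand r A a) (range1 N)))
     ≡⟨ cong (λ z → + a *ᶻ O n +ᶻ + A *ᶻ sumℤ z) (sym (LP.map-∘ (range1 N))) ⟩
  + a *ᶻ O n +ᶻ + A *ᶻ sumℤ (map (λ k → (O ⊛ summand r A a k) n) (range1 N)) ∎
  where
  open ≡-Reasoning
  O = overGF N
  S = sumS (map (summand r A a) (range1 N))


-- Overpartitions with bounded parts

size : Part → ℕ
size = proj₁

plainRun : ℕ → ℕ → OverPartition
plainRun c s = replicate c (s , false)

runs : ℕ → ℕ → List OverPartition
runs s zero = [] ∷ []
runs s (suc c) = plainRun (suc c) s ∷ ((s , true) ∷ plainRun c s) ∷ []

runsIf : ℕ → ℕ → ℕ → List OverPartition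
runsIf s k j = if k ≡ᵇ s * j then runs s j else []

runsOfWeight : ℕ → ℕ → List OverPartition
runsOfWeight s k = concatMap (runsIf s k) (upTo (suc k))

overpartitions≤ : ℕ → ℕ → List OverPartition
overpartitions≤ zero n = if n ≡ᵇ 0 then [] ∷ [] else []
overpartitions≤ (suc M) n =
  concatMap (λ k → concatMap (λ b → map (b ++_) (overpartitions≤ M (n ∸ k))) (runsOfWeight (suc M) k)) (upTo (suc n))

BoundedOverpartition : ℕ → OverPartition → Set
BoundedOverpartition M π = All (λ p → 1 ≤ size p × size p ≤ M) π × Linked Step π

sumParts-++ : ∀ xs ys → sumParts (xs ++ ys) ≡ sumParts xs + sumParts ys
sumParts-++ [] ys = refl
sumParts-++ (x ∷ xs) ys = trans (cong (λ z → size x + z) (sumParts-++ xs ys)) (sym (NP.+-assoc (size x) _ _))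

sumParts-plainRun : ∀ c s → sumParts (plainRun c s) ≡ c * s
sumParts-plainRun zero s = refl
sumParts-plainRun (suc c) s = cong (λ z → s + z) (sumParts-plainRun c s)

length-plainRun : ∀ c s → length (plainRun c s) ≡ c
length-plainRun c s = LP.length-replicate c

sizes≤sumParts : ∀ π → All (λ p → size p ≤ sumParts π) π
sizes≤sumParts [] = []
sizes≤sumParts (p ∷ ps) = NP.m≤m+n (size p) _ ∷ All.map (λ le → NP.≤-trans le (NP.m≤n+m _ (size p))) (sizes≤sumParts ps)

length≤sumParts : ∀ π → All (λ p → 1 ≤ size p) π → length π ≤ sumParts π
length≤sumParts [] _ = z≤n
length≤sumParts (p ∷ ps) (o ∷ al) = NP.+-mono-≤ o (length≤sumParts ps al)

plainRun-linked : ∀ s x c π' → Linked Step π' → All (λ p → size p < s) π' →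
  Linked Step ((s , x) ∷ plainRun c s ++ π')
plainRun-linked s x zero [] _ _ = [-]
plainRun-linked s x zero ((w , y) ∷ ps) lk (w<s ∷ _) = (NP.<⇒≤ w<s , λ e → ⊥-elim (NP.<-irrefl e w<s)) ∷ lk
plainRun-linked s x (suc c) π' lk al = (NP.≤-refl , λ _ → refl) ∷ plainRun-linked s false c π' lk al

record RunProperties (s j : ℕ) (b : OverPartition) : Set where
  field
    weight : sumParts b ≡ j * s
    run-length : length b ≡ j
    sizes : All (λ p → size p ≡ s) b
    linked-++ : ∀ π' → Linked Step π' → All (λ p → size p < s) π' → Linked Step (b ++ π')

All-plainRun-size : ∀ c s → All (λ p → size p ≡ s) (plainRun c s)
All-plainRun-size zero s = []
All-plainRun-size (suc c) s = refl ∷ All-plainRun-size c s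

runs-properties : ∀ s j b → b ∈ runs s j → RunProperties s j b
runs-properties s zero .[] (here refl) = record { weight = refl ; run-length = refl ; sizes = [] ; linked-++ = λ π' lk _ → lk }
runs-properties s (suc c) .(plainRun (suc c) s) (here refl) = record
  { weight = sumParts-plainRun (suc c) s ; run-length = length-plainRun (suc c) s ; sizes = All-plainRun-size (suc c) s
  ; linked-++ = λ π' lk al → plainRun-linked s false c π' lk al }
runs-properties s (suc c) .((s , true) ∷ plainRun c s) (there (here refl)) = record
  { weight = cong (λ z → s + z) (sumParts-plainRun c s) ; run-length = cong suc (length-plainRun c s) ; sizes = refl ∷ All-plainRun-size c s
  ; linked-++ = λ π' lk al → plainRun-linked s true c π' lk al }

∈-runsOfWeight⁻ : ∀ s k b → b ∈ runsOfWeight s k → ∃ λ j → k ≡ s * j × b ∈ runs s j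
∈-runsOfWeight⁻ s k b p with ∈-concatMap⁻′ (runsIf s k) (upTo (suc k)) p
... | j , _ , q with k ≡ᵇ s * j in eq
... | true = j , NP.≡ᵇ⇒≡ k (s * j) (subst T (sym eq) tt) , q

∈-runsOfWeight⁺ : ∀ s k j b → k ≡ s * j → j ≤ k → b ∈ runs s j → b ∈ runsOfWeight s k
∈-runsOfWeight⁺ s k j b e j≤k q = ∈-concatMap⁺′ (runsIf s k) (MP.∈-upTo⁺ (s≤s j≤k)) q'
  where
  q' : b ∈ runsIf s k j
  q' rewrite T⇒≡ (NP.≡⇒≡ᵇ k (s * j) e) = q

overpartitions≤-sound : ∀ M n π → π ∈ overpartitions≤ M n → BoundedOverpartition M π × sumParts π ≡ n
overpartitions≤-sound zero zero .[] (here refl) = ([] , []) , refl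
overpartitions≤-sound zero (suc n) π ()
overpartitions≤-sound (suc M) n π p with ∈-concatMap⁻′ _ (upTo (suc n)) p
... | k , k∈ , p2 with ∈-concatMap⁻′ _ (runsOfWeight (suc M) k) p2
... | b , b∈ , p3 with MP.∈-map⁻ (b ++_) p3
... | π' , π'∈ , refl with overpartitions≤-sound M (n ∸ k) π' π'∈ | ∈-runsOfWeight⁻ (suc M) k b b∈
... | (alπ' , lkπ') , sπ' | j , kj , bj = (AllP.++⁺ alb alπ'' , RunProperties.linked-++ ok π' lkπ' lt) , sm
  where
  s = suc M
  ok = runs-properties s j b bj
  alb : All (λ p → 1 ≤ size p × size p ≤ s) b
  alb = All.map (λ {p} e → subst (λ z → 1 ≤ z × z ≤ s) (sym e) (s≤s z≤n , NP.≤-refl)) (RunProperties.sizes ok)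
  alπ'' : All (λ p → 1 ≤ size p × size p ≤ s) π'
  alπ'' = All.map (λ {p} (a , b) → a , NP.m≤n⇒m≤1+n b) alπ'
  lt : All (λ p → size p < s) π'
  lt = All.map (λ {p} (a , b) → s≤s b) alπ'
  k≤n : k ≤ n
  k≤n = NP.≤-pred (MP.∈-upTo⁻ k∈)
  sm : sumParts (b ++ π') ≡ n
  sm = begin
    sumParts (b ++ π') ≡⟨ sumParts-++ b π' ⟩
    sumParts b + sumParts π' ≡⟨ cong₂ _+_ (trans (RunProperties.weight ok) (trans (NP.*-comm j s) (sym kj))) sπ' ⟩
    k + (n ∸ k) ≡⟨ NP.m+[n∸m]≡n k≤n ⟩
    n ∎
    where open ≡-Reasoning

Linked-head-max : ∀ p qs → Linked Step (p ∷ qs) → All (λ q → size q ≤ size p) qs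
Linked-head-max p [] _ = []
Linked-head-max p (q ∷ qs) (st ∷ lk) = proj₁ st ∷ All.map (λ le → NP.≤-trans le (proj₁ st)) (Linked-head-max q qs lk)

BoundedOverpartition-below : ∀ M w y qs → w ≤ M → All (λ p → 1 ≤ size p × size p ≤ suc M) ((w , y) ∷ qs) → Linked Step ((w , y) ∷ qs) →
  BoundedOverpartition M ((w , y) ∷ qs)
BoundedOverpartition-below M w y qs w≤M ((o , _) ∷ al) lk = ((o , w≤M) ∷ All.zipWith (λ {p} (a , b) → proj₁ a , NP.≤-trans b w≤M) (al , Linked-head-max _ qs lk)) , lk

split-plainRun : ∀ M x ps → Linked Step ((suc M , x) ∷ ps) → All (λ p → 1 ≤ size p × size p ≤ suc M) ps →
  ∃ λ c → ∃ λ π' → ps ≡ plainRun c (suc M) ++ π' × BoundedOverpartition M π'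
split-plainRun M x [] _ _ = 0 , [] , refl , ([] , [])
split-plainRun M x ((w , y) ∷ qs) (st ∷ lk) (a ∷ al) with w ≟ suc M
... | yes refl with proj₂ st refl
... | refl with split-plainRun M false qs lk al
... | c , π' , e , v = suc c , π' , cong ((suc M , false) ∷_) e , v
split-plainRun M x ((w , y) ∷ qs) (st ∷ lk) (a ∷ al) | no ne =
  0 , (w , y) ∷ qs , refl , BoundedOverpartition-below M w y qs (NP.≤-pred (NP.≤∧≢⇒< (proj₂ a) ne)) (a ∷ al) lk

split-largestRun : ∀ M π → BoundedOverpartition (suc M) π → ∃ λ j → ∃ λ b → ∃ λ π' → π ≡ b ++ π' × b ∈ runs (suc M) j × BoundedOverpartition M π'
split-largestRun M [] _ = 0 , [] , [] , refl , here refl , ([] , [])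
split-largestRun M ((w , x) ∷ ps) (a ∷ al , lk) with w ≟ suc M
... | yes refl with split-plainRun M x ps lk al
... | c , π' , refl , v = suc c , (suc M , x) ∷ plainRun c (suc M) , π' , refl , mem x , v
  where
  mem : ∀ x → ((suc M , x) ∷ plainRun c (suc M)) ∈ runs (suc M) (suc c)
  mem false = here refl
  mem true = there (here refl)
split-largestRun M ((w , x) ∷ ps) (a ∷ al , lk) | no ne =
  0 , [] , (w , x) ∷ ps , refl , here refl , BoundedOverpartition-below M w x ps (NP.≤-pred (NP.≤∧≢⇒< (proj₂ a) ne)) (a ∷ al) lk

overpartitions≤-complete : ∀ M π → BoundedOverpartition M π → π ∈ overpartitions≤ M (sumParts π)
overpartitions≤-complete zero [] v = here refl
overpartitions≤-complete zero (p ∷ π) ((a , b) ∷ _ , _) with NP.≤-trans a b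
... | ()
overpartitions≤-complete (suc M) π v with split-largestRun M π v
... | j , b , π' , refl , bj , v' =
  ∈-concatMap⁺′ (λ k → concatMap (λ b → map (b ++_) (overpartitions≤ M (n ∸ k))) (runsOfWeight s k)) (MP.∈-upTo⁺ (s≤s k≤n))
    (∈-concatMap⁺′ (λ b → map (b ++_) (overpartitions≤ M (n ∸ k))) b∈ (MP.∈-map⁺ (b ++_) π'∈))
  where
  s = suc M
  n = sumParts (b ++ π')
  k = sumParts b
  ok = runs-properties s j b bj
  n≡ : n ≡ k + sumParts π'
  n≡ = sumParts-++ b π'
  k≤n : k ≤ n
  k≤n = subst (k ≤_) (sym n≡) (NP.m≤m+n k _)
  kj : k ≡ s * j
  kj = trans (RunProperties.weight ok) (NP.*-comm j s)
  b∈ : b ∈ runsOfWeight s k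
  b∈ = ∈-runsOfWeight⁺ s k j b kj (subst (j ≤_) (sym kj) (NP.m≤n*m j s)) bj
  π'∈ : π' ∈ overpartitions≤ M (n ∸ k)
  π'∈ = subst (λ z → π' ∈ overpartitions≤ M z) (sym (trans (cong (_∸ k) n≡) (NP.m+n∸m≡n k _))) (overpartitions≤-complete M π' v')

leadingRun : ℕ → OverPartition → OverPartition
leadingRun s [] = []
leadingRun s (p ∷ ps) = if size p ≡ᵇ s then p ∷ leadingRun s ps else []

leadingRun-++ : ∀ s b π' → All (λ p → size p ≡ s) b → All (λ p → size p < s) π' → leadingRun s (b ++ π') ≡ b
leadingRun-++ s [] [] _ _ = refl
leadingRun-++ s [] ((w , x) ∷ π') _ (lt ∷ _) rewrite ≡ᵇ-≢ w s (NP.<⇒≢ lt) = refl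
leadingRun-++ s ((w , x) ∷ b) π' (e ∷ al) lt rewrite trans (cong (w ≡ᵇ_) (sym e)) (≡ᵇ-refl w) =
  cong ((w , x) ∷_) (leadingRun-++ s b π' al lt)

runs-unique : ∀ s j → Unique (runs s j)
runs-unique s zero = [] ∷ []
runs-unique s (suc c) = ((λ ()) ∷ []) ∷ ([] ∷ [])

runsIf-unique : ∀ s k j → Unique (runsIf s k j)
runsIf-unique s k j with k ≡ᵇ s * j
... | true = runs-unique s j
... | false = []

runsOfWeight-unique : ∀ s k → Unique (runsOfWeight s k)
runsOfWeight-unique s k = Unique-concatMap (runsIf s k) length (upTo (suc k)) (UP.upTo⁺ (suc k)) (λ j _ → runsIf-unique s k j) tg
  where
  tg : ∀ j → j ∈ upTo (suc k) → ∀ b → b ∈ runsIf s k j → length b ≡ j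
  tg j _ b b∈ with k ≡ᵇ s * j
  ... | true = RunProperties.run-length (runs-properties s j b b∈)

overpartitions≤-unique : ∀ M n → Unique (overpartitions≤ M n)
overpartitions≤-unique zero n with n ≡ᵇ 0
... | true = [] ∷ []
... | false = []
overpartitions≤-unique (suc M) n = Unique-concatMap F (λ π → sumParts (leadingRun s π)) (upTo (suc n)) (UP.upTo⁺ (suc n))
  (λ k _ → inner k) tg1
  where
  s = suc M
  G : ℕ → OverPartition → List OverPartition
  G k b = map (b ++_) (overpartitions≤ M (n ∸ k))
  F : ℕ → List OverPartition
  F k = concatMap (G k) (runsOfWeight s k)
  preG : ∀ k b → b ∈ runsOfWeight s k → ∀ y → y ∈ G k b → leadingRun s y ≡ b × sumParts b ≡ k
  preG k b b∈ y y∈ with MP.∈-map⁻ (b ++_) y∈ | ∈-runsOfWeight⁻ s k b b∈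
  ... | π' , π'∈ , refl | j , kj , bj =
    leadingRun-++ s b π' (RunProperties.sizes ok) (All.map (λ {p} (a , c) → s≤s c) (proj₁ (proj₁ (overpartitions≤-sound M (n ∸ k) π' π'∈)))) ,
    trans (RunProperties.weight ok) (trans (NP.*-comm j s) (sym kj))
    where ok = runs-properties s j b bj
  inner : ∀ k → Unique (F k)
  inner k = Unique-concatMap (G k) (leadingRun s) (runsOfWeight s k) (runsOfWeight-unique s k)
    (λ b _ → UP.map⁺ (λ {ys} {zs} → LP.++-cancelˡ b ys zs) (overpartitions≤-unique M (n ∸ k))) (λ b b∈ y y∈ → proj₁ (preG k b b∈ y y∈))
  tg1 : ∀ k → k ∈ upTo (suc n) → ∀ y → y ∈ F k → sumParts (leadingRun s y) ≡ k
  tg1 k _ y y∈ with ∈-concatMap⁻′ (G k) (runsOfWeight s k) y∈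
  ... | b , b∈ , y∈' with preG k b b∈ y y∈'
  ... | e1 , e2 = trans (cong sumParts e1) e2

IsOverpartitionOf⇔∈-overpartitions≤ : ∀ {n N} π → n ≤ N → IsOverpartitionOf n π ⇔ π ∈ overpartitions≤ N n
IsOverpartitionOf⇔∈-overpartitions≤ {n} {N} π n≤N = mk⇔ to from
  where
  to : IsOverpartitionOf n π → π ∈ overpartitions≤ N n
  to (pos , linked , refl) = overpartitions≤-complete N π
    (All.zipWith (λ (o , le) → o , NP.≤-trans le n≤N) (pos , sizes≤sumParts π) , linked)
  from : π ∈ overpartitions≤ N n → IsOverpartitionOf n π
  from π∈ with overpartitions≤-sound N n π π∈
  ... | (bounds , linked) , sum≡n = All.map proj₁ bounds , linked , sum≡n

↭-overpartitions≤ : ∀ {n N} {L : List OverPartition} → Unique L → (∀ π → (π ∈ L) ⇔ IsOverpartitionOf n π) → n ≤ N →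
  L ↭ overpartitions≤ N n
↭-overpartitions≤ {n} {N} uniq L⇔ n≤N = ∼bag⇒↭ (unique∧set⇒bag uniq (overpartitions≤-unique N n)
  (λ {π} → mk⇔ (λ π∈ → Equivalence.to (IsOverpartitionOf⇔∈-overpartitions≤ π n≤N) (Equivalence.to (L⇔ π) π∈))
                (λ π∈ → Equivalence.from (L⇔ π) (Equivalence.from (IsOverpartitionOf⇔∈-overpartitions≤ π n≤N) π∈))))


-- Blocked sizes

count : (OverPartition → Bool) → List OverPartition → ℕ
count p xs = sumℕ (map (λ π → toℕ (p π)) xs)

blocked : ℕ → OverPartition → ℕ → Bool
blocked r π m = not (mesCond r π m)

blockedOn : ℕ → (ℕ → Bool) → ℕ → OverPartition → Bool
blockedOn r g zero π = true
blockedOn r g (suc M) π = (not (g (suc M)) ∨ blocked r π (suc M)) ∧ blockedOn r g M π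

hasOver-++ : ∀ xs ys m → hasOver (xs ++ ys) m ≡ hasOver xs m ∨ hasOver ys m
hasOver-++ [] ys m = refl
hasOver-++ ((w , b) ∷ xs) ys m rewrite hasOver-++ xs ys m = sym (BP.∨-assoc ((w ≡ᵇ m) ∧ b) _ _)

countNon-++ : ∀ xs ys m → countNon (xs ++ ys) m ≡ countNon xs m + countNon ys m
countNon-++ [] ys m = refl
countNon-++ ((w , b) ∷ xs) ys m rewrite countNon-++ xs ys m = sym (NP.+-assoc (if (w ≡ᵇ m) ∧ not b then 1 else 0) _ _)

hasOver-none : ∀ xs m → All (λ p → size p ≢ m) xs → hasOver xs m ≡ false
hasOver-none [] m _ = refl
hasOver-none ((w , b) ∷ xs) m (ne ∷ al) rewrite ≡ᵇ-≢ w m ne = hasOver-none xs m al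

countNon-none : ∀ xs m → All (λ p → size p ≢ m) xs → countNon xs m ≡ 0
countNon-none [] m _ = refl
countNon-none ((w , b) ∷ xs) m (ne ∷ al) rewrite ≡ᵇ-≢ w m ne = countNon-none xs m al

blocked-++ˡ : ∀ r xs ys m → All (λ p → size p ≢ m) xs → blocked r (xs ++ ys) m ≡ blocked r ys m
blocked-++ˡ r xs ys m al rewrite hasOver-++ xs ys m | countNon-++ xs ys m | hasOver-none xs m al | countNon-none xs m al = refl

blocked-++ʳ : ∀ r xs ys m → All (λ p → size p ≢ m) ys → blocked r (xs ++ ys) m ≡ blocked r xs m
blocked-++ʳ r xs ys m al rewrite hasOver-++ xs ys m | countNon-++ xs ys m | hasOver-none ys m al | countNon-none ys m al
  | BP.∨-identityʳ (hasOver xs m) | NP.+-identityʳ (countNon xs m) = refl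

blockedOn-++ˡ : ∀ r g M xs ys → All (λ p → M < size p) xs → blockedOn r g M (xs ++ ys) ≡ blockedOn r g M ys
blockedOn-++ˡ r g zero xs ys al = refl
blockedOn-++ˡ r g (suc M) xs ys al
  rewrite blocked-++ˡ r xs ys (suc M) (All.map (λ lt e → NP.<-irrefl (sym e) lt) al)
        | blockedOn-++ˡ r g M xs ys (All.map (λ lt → NP.≤-trans (NP.n≤1+n (suc M)) lt) al) = refl

hasOver-plainRun : ∀ c s m → hasOver (plainRun c s) m ≡ false
hasOver-plainRun zero s m = refl
hasOver-plainRun (suc c) s m rewrite BP.∧-zeroʳ (s ≡ᵇ m) = hasOver-plainRun c s m

countNon-plainRun : ∀ c s → countNon (plainRun c s) s ≡ c
countNon-plainRun zero s = refl
countNon-plainRun (suc c) s rewrite ≡ᵇ-refl s = cong suc (countNon-plainRun c s)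

blocked-plainRun : ∀ r c s → blocked r (plainRun c s) s ≡ false
blocked-plainRun r c s rewrite hasOver-plainRun c s s = refl

blocked-overlinedRun : ∀ r c s → blocked r ((s , true) ∷ plainRun c s) s ≡ not (c <ᵇ r ∸ 1)
blocked-overlinedRun r c s rewrite ≡ᵇ-refl s | countNon-plainRun c s = refl

hasOver⇒∈sizes : ∀ π m → hasOver π m ≡ true → m ∈ map size π
hasOver⇒∈sizes ((w , b) ∷ π) m e with w ≡ᵇ m in ew
... | true with b
... | true = here (sym (NP.≡ᵇ⇒≡ w m (subst T (sym ew) tt)))
... | false = there (hasOver⇒∈sizes π m e)
hasOver⇒∈sizes ((w , b) ∷ π) m e | false = there (hasOver⇒∈sizes π m e)

blockedOn-cong : ∀ r g h M π → (∀ s → s ≤ M → g s ≡ h s) → blockedOn r g M π ≡ blockedOn r h M π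
blockedOn-cong r g h zero π e = refl
blockedOn-cong r g h (suc M) π e = cong₂ _∧_ (cong (λ b → not b ∨ blocked r π (suc M)) (e (suc M) NP.≤-refl))
  (blockedOn-cong r g h M π (λ s s≤M → e s (NP.m≤n⇒m≤1+n s≤M)))

blockedOn-nothing : ∀ r M π → blockedOn r (λ _ → false) M π ≡ true
blockedOn-nothing r zero π = refl
blockedOn-nothing r (suc M) π = blockedOn-nothing r M π

∧-absorb-guard : ∀ x y G → x ∧ G ≡ ((y ∨ x) ∧ G) ∧ x
∧-absorb-guard true y G rewrite BP.∨-zeroʳ y = sym (BP.∧-identityʳ G)
∧-absorb-guard false y G = sym (BP.∧-zeroʳ _)

blockedOn-insert : ∀ r g m M π → 1 ≤ m → m ≤ M → blockedOn r (λ s → g s ∨ (s ≡ᵇ m)) M π ≡ blockedOn r g M π ∧ blocked r π m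
blockedOn-insert r g m zero π 1≤m m≤0 with NP.≤-trans 1≤m m≤0
... | ()
blockedOn-insert r g m (suc M) π 1≤m m≤sM with suc M ≟ m
... | yes refl = begin
  (not (g (suc M) ∨ (suc M ≡ᵇ suc M)) ∨ x) ∧ blockedOn r h M π
    ≡⟨ cong₂ (λ b G → (not (g (suc M) ∨ b) ∨ x) ∧ G) (≡ᵇ-refl (suc M))
        (blockedOn-cong r h g M π (λ s s≤M → trans (cong (g s ∨_) (≡ᵇ-≢ s (suc M) (NP.<⇒≢ (s≤s s≤M)))) (BP.∨-identityʳ (g s)))) ⟩
  (not (g (suc M) ∨ true) ∨ x) ∧ blockedOn r g M π ≡⟨ cong (λ b → (not b ∨ x) ∧ blockedOn r g M π) (BP.∨-zeroʳ (g (suc M))) ⟩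
  x ∧ blockedOn r g M π ≡⟨ ∧-absorb-guard x (not (g (suc M))) (blockedOn r g M π) ⟩
  ((not (g (suc M)) ∨ x) ∧ blockedOn r g M π) ∧ x ∎
  where
  open ≡-Reasoning
  h = λ s → g s ∨ (s ≡ᵇ suc M)
  x = blocked r π (suc M)
... | no ne = begin
  (not (g (suc M) ∨ (suc M ≡ᵇ m)) ∨ y) ∧ blockedOn r h M π
    ≡⟨ cong₂ (λ b G → (not b ∨ y) ∧ G) (trans (cong (g (suc M) ∨_) (≡ᵇ-≢ (suc M) m ne)) (BP.∨-identityʳ _))
        (blockedOn-insert r g m M π 1≤m (NP.≤-pred (NP.≤∧≢⇒< m≤sM (λ e → ne (sym e))))) ⟩
  (not (g (suc M)) ∨ y) ∧ (blockedOn r g M π ∧ blocked r π m) ≡⟨ sym (BP.∧-assoc (not (g (suc M)) ∨ y) (blockedOn r g M π) (blocked r π m)) ⟩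
  ((not (g (suc M)) ∨ y) ∧ blockedOn r g M π) ∧ blocked r π m ∎
  where
  open ≡-Reasoning
  h = λ s → g s ∨ (s ≡ᵇ m)
  y = blocked r π (suc M)


-- Generating function of overpartitions with prescribed blocked sizes

countBlocked : ℕ → (ℕ → Bool) → ℕ → ℕ → ℕ
countBlocked r g M n = count (blockedOn r g M) (overpartitions≤ M n)

runBlocked : ℕ → (ℕ → Bool) → ℕ → OverPartition → Bool
runBlocked r g s b = not (g s) ∨ blocked r b s

runCount : ℕ → (ℕ → Bool) → ℕ → ℕ → ℕ
runCount r g s k = count (runBlocked r g s) (runsOfWeight s k)

blockedOn-++ : ∀ r g M k b j y → b ∈ runsOfWeight (suc M) k → y ∈ overpartitions≤ M j →
  blockedOn r g (suc M) (b ++ y) ≡ runBlocked r g (suc M) b ∧ blockedOn r g M y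
blockedOn-++ r g M k b j y b∈ y∈ with ∈-runsOfWeight⁻ (suc M) k b b∈
... | j' , _ , bj
  rewrite blocked-++ʳ r b y (suc M) (All.map (λ {p} (a , c) e → NP.<-irrefl e (s≤s c)) (proj₁ (proj₁ (overpartitions≤-sound M j y y∈))))
        | blockedOn-++ˡ r g M b y (All.map (λ {p} e → subst (M <_) (sym e) (NP.n<1+n M)) (RunProperties.sizes (runs-properties (suc M) j' b bj))) = refl

countBlocked-suc : ∀ r g M n → countBlocked r g (suc M) n ≡ sumℕ (map (λ k → runCount r g (suc M) k * countBlocked r g M (n ∸ k)) (upTo (suc n)))
countBlocked-suc r g M n = begin
  countBlocked r g (suc M) n ≡⟨ sumℕ-concatMap h F (upTo (suc n)) ⟩
  sumℕ (map (λ k → sumℕ (map h (F k))) (upTo (suc n)))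
    ≡⟨ sumℕ-cong∈ _ _ (upTo (suc n)) (λ k _ → trans (sumℕ-concatMap h (Gk k) (runsOfWeight s k)) (inner k)) ⟩
  sumℕ (map (λ k → runCount r g s k * countBlocked r g M (n ∸ k)) (upTo (suc n))) ∎
  where
  open ≡-Reasoning
  s = suc M
  h : OverPartition → ℕ
  h π = toℕ (blockedOn r g s π)
  Gk : ℕ → OverPartition → List OverPartition
  Gk k b = map (b ++_) (overpartitions≤ M (n ∸ k))
  F : ℕ → List OverPartition
  F k = concatMap (Gk k) (runsOfWeight s k)
  perb : ∀ k b → b ∈ runsOfWeight s k → sumℕ (map h (Gk k b)) ≡ toℕ (runBlocked r g s b) * countBlocked r g M (n ∸ k)
  perb k b b∈ = begin
    sumℕ (map h (map (b ++_) (overpartitions≤ M (n ∸ k)))) ≡⟨ cong sumℕ (sym (LP.map-∘ (overpartitions≤ M (n ∸ k)))) ⟩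
    sumℕ (map (λ y → h (b ++ y)) (overpartitions≤ M (n ∸ k)))
      ≡⟨ sumℕ-cong∈ _ _ (overpartitions≤ M (n ∸ k)) (λ y y∈ → trans (cong toℕ (blockedOn-++ r g M k b (n ∸ k) y b∈ y∈)) (toℕ-∧ (runBlocked r g s b) (blockedOn r g M y))) ⟩
    sumℕ (map (λ y → toℕ (runBlocked r g s b) * toℕ (blockedOn r g M y)) (overpartitions≤ M (n ∸ k))) ≡⟨ sumℕ-*ˡ (λ y → toℕ (blockedOn r g M y)) (toℕ (runBlocked r g s b)) (overpartitions≤ M (n ∸ k)) ⟩
    toℕ (runBlocked r g s b) * countBlocked r g M (n ∸ k) ∎
  inner : ∀ k → sumℕ (map (λ b → sumℕ (map h (Gk k b))) (runsOfWeight s k)) ≡ runCount r g s k * countBlocked r g M (n ∸ k)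
  inner k = trans (sumℕ-cong∈ _ _ (runsOfWeight s k) (perb k)) (sumℕ-*ʳ (λ b → toℕ (runBlocked r g s b)) _ (runsOfWeight s k))

countBlockedSeries : ℕ → (ℕ → Bool) → ℕ → Series
countBlockedSeries r g M j = + countBlocked r g M j

runSeries : ℕ → (ℕ → Bool) → ℕ → Series
runSeries r g s k = + runCount r g s k

countBlockedSeries-suc : ∀ r g M → countBlockedSeries r g (suc M) ≈ runSeries r g (suc M) ⊛ countBlockedSeries r g M
countBlockedSeries-suc r g M n = begin
  + countBlocked r g (suc M) n ≡⟨ cong +_ (countBlocked-suc r g M n) ⟩
  + sumℕ (map (λ k → runCount r g (suc M) k * countBlocked r g M (n ∸ k)) (upTo (suc n))) ≡⟨ +-sumℕ _ (upTo (suc n)) ⟩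
  sumTo (suc n) (λ k → + (runCount r g (suc M) k * countBlocked r g M (n ∸ k)))
    ≡⟨ sumTo-cong (suc n) _ _ (λ k _ → ZP.pos-* (runCount r g (suc M) k) _) ⟩
  (runSeries r g (suc M) ⊛ countBlockedSeries r g M) n ∎
  where open ≡-Reasoning

countBlockedSeries-zero : ∀ r g → countBlockedSeries r g 0 ≈ one
countBlockedSeries-zero r g zero = refl
countBlockedSeries-zero r g (suc n) = refl

runCountByParts : ℕ → (ℕ → Bool) → ℕ → ℕ → ℕ
runCountByParts r g s j = count (runBlocked r g s) (runs s j)

runCount-sumTo : ∀ r g s k → + runCount r g s k ≡ sumTo (suc k) (λ j → ι (k ≡ᵇ s * j) *ᶻ + runCountByParts r g s j)
runCount-sumTo r g s k = begin
  + runCount r g s k ≡⟨ cong +_ (sumℕ-concatMap (λ π → toℕ (runBlocked r g s π)) (runsIf s k) (upTo (suc k))) ⟩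
  + sumℕ (map (λ j → count (runBlocked r g s) (runsIf s k j)) (upTo (suc k))) ≡⟨ +-sumℕ _ (upTo (suc k)) ⟩
  sumTo (suc k) (λ j → + count (runBlocked r g s) (runsIf s k j)) ≡⟨ sumTo-cong (suc k) _ _ (λ j _ → per j) ⟩
  sumTo (suc k) (λ j → ι (k ≡ᵇ s * j) *ᶻ + runCountByParts r g s j) ∎
  where
  open ≡-Reasoning
  per : ∀ j → + count (runBlocked r g s) (runsIf s k j) ≡ ι (k ≡ᵇ s * j) *ᶻ + runCountByParts r g s j
  per j with k ≡ᵇ s * j
  ... | true = sym (ZP.*-identityˡ (+ runCountByParts r g s j))
  ... | false = sym (ZP.*-zeroˡ (+ runCountByParts r g s j))

runCount-multiple : ∀ r g M k t → k ≡ suc M * t → + runCount r g (suc M) k ≡ + runCountByParts r g (suc M) t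
runCount-multiple r g M k t e = trans (runCount-sumTo r g (suc M) k)
  (sumTo-indicator-unique (suc k) (λ j → k ≡ᵇ suc M * j) (λ j → + runCountByParts r g (suc M) j) t
    (λ j _ pj → NP.*-cancelˡ-≡ j t (suc M) (trans (sym (NP.≡ᵇ⇒≡ k _ pj)) e))
    (NP.≡⇒≡ᵇ k _ e)
    (s≤s (subst (t ≤_) (sym e) (NP.m≤n*m t (suc M)))))

runCount-nonmultiple : ∀ r g M k → (∀ t → k ≢ suc M * t) → + runCount r g (suc M) k ≡ + 0
runCount-nonmultiple r g M k miss = trans (runCount-sumTo r g (suc M) k)
  (sumTo-indicator-none (suc k) (λ j → k ≡ᵇ suc M * j) (λ j → + runCountByParts r g (suc M) j) (λ j _ pj → miss j (NP.≡ᵇ⇒≡ k _ pj)))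

runCountByParts-free-zero : ∀ r g s → g s ≡ false → runCountByParts r g s 0 ≡ 1
runCountByParts-free-zero r g s e rewrite e = refl

runCountByParts-free-suc : ∀ r g s c → g s ≡ false → runCountByParts r g s (suc c) ≡ 2
runCountByParts-free-suc r g s c e rewrite e = refl

runCountByParts-blocked-zero : ∀ r g s → g s ≡ true → runCountByParts r g s 0 ≡ 0
runCountByParts-blocked-zero r g s e rewrite e = refl

runCountByParts-blocked-suc : ∀ r g s c → g s ≡ true → runCountByParts r g s (suc c) ≡ toℕ (not (c <ᵇ r ∸ 1))
runCountByParts-blocked-suc r g s c e rewrite e | blocked-plainRun r (suc c) s | blocked-overlinedRun r c s = NP.+-identityʳ _

geom : ℕ → Series
geom s = geomInv (+ 1) s

freeFactor : ℕ → Series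
freeFactor s = onePlus s ⊛ geom s

blockedFactor : ℕ → ℕ → Series
blockedFactor r s = mono (r * s) ⊛ geom s

runSeries-free : ∀ r g M → g (suc M) ≡ false → runSeries r g (suc M) ≈ freeFactor (suc M)
runSeries-free r g M e k = trans (go k (multiple? M k)) (sym (onePlus-⊛-coeff s (geom s) k))
  where
  s = suc M
  go : ∀ k → (∃ λ t → k ≡ s * t) ⊎ (∀ t → k ≢ s * t) → + runCount r g s k ≡ geom s k +ᶻ shift s (geom s) k
  go k (inj₁ (zero , eq)) with trans eq (NP.*-zeroʳ s)
  ... | refl = trans (runCount-multiple r g M 0 0 (sym (NP.*-zeroʳ s))) (trans (cong +_ (runCountByParts-free-zero r g s e))
                 (sym (cong (_+ᶻ + 0) (geomInv-coeff-multiple (+ 1) M 0 0 (sym (NP.*-zeroʳ s))))))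
  go k (inj₁ (suc c , eq)) rewrite eq = begin
    + runCount r g s (s * suc c) ≡⟨ runCount-multiple r g M _ (suc c) refl ⟩
    + runCountByParts r g s (suc c) ≡⟨ cong +_ (runCountByParts-free-suc r g s c e) ⟩
    + 1 +ᶻ + 1 ≡⟨ sym (cong₂ _+ᶻ_ (trans (geomInv-coeff-multiple (+ 1) M _ (suc c) refl) (ZP.^-zeroˡ (suc c)))
        (trans (shift-coeff-≥ s (geom s) _ (NP.m≤m*n s (suc c))) (trans (geomInv-coeff-multiple (+ 1) M _ c e2) (ZP.^-zeroˡ c)))) ⟩
    geom s (s * suc c) +ᶻ shift s (geom s) (s * suc c) ∎
    where
    open ≡-Reasoning
    e2 : s * suc c ∸ s ≡ s * c
    e2 = trans (cong (_∸ s) (NP.*-suc s c)) (NP.m+n∸m≡n s _)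
  go k (inj₂ miss) with s ≤? k
  ... | yes le = trans (runCount-nonmultiple r g M k miss) (sym (cong₂ _+ᶻ_ (geomInv-coeff-nonmultiple (+ 1) M k miss)
                  (trans (shift-coeff-≥ s (geom s) k le) (geomInv-coeff-nonmultiple (+ 1) M _ miss2))))
    where
    miss2 : ∀ t → k ∸ s ≢ s * t
    miss2 t eq = miss (suc t) (trans (sym (NP.m+[n∸m]≡n le)) (trans (cong (λ z → s + z) eq) (sym (NP.*-suc s t))))
  ... | no nle = trans (runCount-nonmultiple r g M k miss) (sym (cong₂ _+ᶻ_ (geomInv-coeff-nonmultiple (+ 1) M k miss) (shift-coeff-< s (geom s) k (NP.≰⇒> nle))))

runSeries-blocked-multiple : ∀ r g M t → 2 ≤ r → g (suc M) ≡ true →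
  + runCount r g (suc M) (suc M * t) ≡ shift (r * suc M) (geom (suc M)) (suc M * t)
runSeries-blocked-multiple r g M zero 2≤r e = begin
  + runCount r g s (s * 0)     ≡⟨ runCount-multiple r g M _ 0 refl ⟩
  + runCountByParts r g s 0    ≡⟨ cong +_ (runCountByParts-blocked-zero r g s e) ⟩
  + 0                          ≡⟨ shift-coeff-< (r * s) (geom s) (s * 0) (subst (_< r * s) (sym (NP.*-zeroʳ s)) (NP.*-mono-≤ (NP.≤-trans (s≤s z≤n) 2≤r) (s≤s z≤n))) ⟨
  shift (r * s) (geom s) (s * 0) ∎
  where
  open ≡-Reasoning
  s = suc M
runSeries-blocked-multiple r g M (suc c) 2≤r e with c <? r ∸ 1
... | yes lt = begin
  + runCount r g s (s * suc c)     ≡⟨ runCount-multiple r g M _ (suc c) refl ⟩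
  + runCountByParts r g s (suc c)  ≡⟨ cong +_ (trans (runCountByParts-blocked-suc r g s c e) (cong (λ z → toℕ (not z)) (T⇒≡ (NP.<⇒<ᵇ lt)))) ⟩
  + 0                              ≡⟨ shift-coeff-< (r * s) (geom s) _ sc*s<r*s ⟨
  shift (r * s) (geom s) (s * suc c) ∎
  where
  open ≡-Reasoning
  s = suc M
  sc<r : suc c < r
  sc<r = subst (suc c <_) (NP.m+[n∸m]≡n (NP.≤-trans (s≤s z≤n) 2≤r)) (s≤s lt)
  sc*s<r*s : s * suc c < r * s
  sc*s<r*s = subst (_< r * s) (NP.*-comm (suc c) s) (NP.*-monoˡ-< s sc<r)
... | no nlt = begin
  + runCount r g s (s * suc c)     ≡⟨ runCount-multiple r g M _ (suc c) refl ⟩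
  + runCountByParts r g s (suc c)  ≡⟨ cong +_ (trans (runCountByParts-blocked-suc r g s c e) (cong (λ z → toℕ (not z)) (¬T⇒≡ (λ t → nlt (NP.<ᵇ⇒< c _ t))))) ⟩
  + 1                              ≡⟨ trans (shift-coeff-≥ (r * s) (geom s) _ r*s≤sc*s) (trans (geomInv-coeff-multiple (+ 1) M _ (suc c ∸ r) quotient) (ZP.^-zeroˡ (suc c ∸ r))) ⟨
  shift (r * s) (geom s) (s * suc c) ∎
  where
  open ≡-Reasoning
  s = suc M
  r≤sc : r ≤ suc c
  r≤sc = subst (_≤ suc c) (NP.m+[n∸m]≡n (NP.≤-trans (s≤s z≤n) 2≤r)) (s≤s (NP.≮⇒≥ nlt))
  r*s≤sc*s : r * s ≤ s * suc c
  r*s≤sc*s = subst (r * s ≤_) (NP.*-comm (suc c) s) (NP.*-monoˡ-≤ s r≤sc)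
  quotient : s * suc c ∸ r * s ≡ s * (suc c ∸ r)
  quotient = trans (cong (s * suc c ∸_) (NP.*-comm r s)) (sym (NP.*-distribˡ-∸ s (suc c) r))

runSeries-blocked-nonmultiple : ∀ r g M k → (∀ t → k ≢ suc M * t) →
  + runCount r g (suc M) k ≡ shift (r * suc M) (geom (suc M)) k
runSeries-blocked-nonmultiple r g M k miss with r * suc M ≤? k
... | yes le = trans (runCount-nonmultiple r g M k miss)
  (sym (trans (shift-coeff-≥ (r * suc M) (geom (suc M)) k le) (geomInv-coeff-nonmultiple (+ 1) M _ miss′)))
  where
  miss′ : ∀ t → k ∸ r * suc M ≢ suc M * t
  miss′ t eq = miss (r + t) (begin
    k                              ≡⟨ NP.m+[n∸m]≡n le ⟨
    r * suc M + (k ∸ r * suc M)    ≡⟨ cong (λ z → r * suc M + z) eq ⟩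
    r * suc M + suc M * t          ≡⟨ cong (_+ suc M * t) (NP.*-comm r (suc M)) ⟩
    suc M * r + suc M * t          ≡⟨ NP.*-distribˡ-+ (suc M) r t ⟨
    suc M * (r + t) ∎)
    where open ≡-Reasoning
... | no nle = trans (runCount-nonmultiple r g M k miss) (sym (shift-coeff-< (r * suc M) (geom (suc M)) k (NP.≰⇒> nle)))

runSeries-blocked : ∀ r g M → 2 ≤ r → g (suc M) ≡ true → runSeries r g (suc M) ≈ blockedFactor r (suc M)
runSeries-blocked r g M 2≤r e k = trans (go (multiple? M k)) (sym (mono-⊛ (r * suc M) (geom (suc M)) k))
  where
  go : (∃ λ t → k ≡ suc M * t) ⊎ (∀ t → k ≢ suc M * t) → + runCount r g (suc M) k ≡ shift (r * suc M) (geom (suc M)) k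
  go (inj₁ (t , refl)) = runSeries-blocked-multiple r g M t 2≤r e
  go (inj₂ miss) = runSeries-blocked-nonmultiple r g M k miss

factor : ℕ → (ℕ → Bool) → ℕ → Series
factor r g s = if g s then blockedFactor r s else freeFactor s

runSeries≈factor : ∀ r g M → 2 ≤ r → runSeries r g (suc M) ≈ factor r g (suc M)
runSeries≈factor r g M 2≤r = helper (g (suc M)) refl
  where
  helper : ∀ b → g (suc M) ≡ b → runSeries r g (suc M) ≈ (if b then blockedFactor r (suc M) else freeFactor (suc M))
  helper true e = runSeries-blocked r g M 2≤r e
  helper false e = runSeries-free r g M e

countBlockedSeries≈prodTo-factor : ∀ r g M → 2 ≤ r → countBlockedSeries r g M ≈ prodTo (factor r g) M
countBlockedSeries≈prodTo-factor r g zero _ = countBlockedSeries-zero r g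
countBlockedSeries≈prodTo-factor r g (suc M) 2≤r = ≈-trans (countBlockedSeries-suc r g M)
  (⊛-cong _ _ _ _ (runSeries≈factor r g M 2≤r) (countBlockedSeries≈prodTo-factor r g M 2≤r))


candidate : ℕ → ℕ → ℕ → ℕ
candidate a A j = a + j * A

earlyCandidate : ℕ → ℕ → ℕ → ℕ → Bool
earlyCandidate a A zero s = false
earlyCandidate a A (suc k) s = earlyCandidate a A k s ∨ (s ≡ᵇ candidate a A k)

blockingRatio : ℕ → ℕ → ℕ → ℕ → Series
blockingRatio r a A k = mono (r * candidate a A k) ⊛ geomInv ℤ.-1ℤ (candidate a A k)

blockingRatios : ℕ → ℕ → ℕ → ℕ → Series
blockingRatios r a A zero = one
blockingRatios r a A (suc k) = blockingRatios r a A k ⊛ blockingRatio r a A k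

candidate-injective : ∀ a A' i j → candidate a (suc A') i ≡ candidate a (suc A') j → i ≡ j
candidate-injective a A' i j e = NP.*-cancelʳ-≡ i j (suc A') (NP.+-cancelˡ-≡ a _ _ e)

earlyCandidate-false : ∀ a A k s → (∀ j → j < k → s ≢ candidate a A j) → earlyCandidate a A k s ≡ false
earlyCandidate-false a A zero s _ = refl
earlyCandidate-false a A (suc k) s ne rewrite earlyCandidate-false a A k s (λ j j<k → ne j (NP.m<n⇒m<1+n j<k)) = ≡ᵇ-≢ s _ (ne k (NP.n<1+n k))

blockedFactor≈freeFactor⊛blockingRatio : ∀ r m' → blockedFactor r (suc m') ≈ freeFactor (suc m') ⊛ (mono (r * suc m') ⊛ geomInv ℤ.-1ℤ (suc m'))
blockedFactor≈freeFactor⊛blockingRatio r m' = ≈-sym (begin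
  (onePlus m ⊛ geom m) ⊛ (Mo ⊛ Gm) ≈⟨ ⊛-congʳ (onePlus m ⊛ geom m) (⊛-comm Mo Gm) ⟩
  (onePlus m ⊛ geom m) ⊛ (Gm ⊛ Mo) ≈⟨ ⊛-interchange (onePlus m) (geom m) Gm Mo ⟩
  (onePlus m ⊛ Gm) ⊛ (geom m ⊛ Mo) ≈⟨ ⊛-congˡ (geom m ⊛ Mo) (onePlus-⊛-geomInv m') ⟩
  one ⊛ (geom m ⊛ Mo) ≈⟨ ⊛-identityˡ (geom m ⊛ Mo) ⟩
  geom m ⊛ Mo ≈⟨ ⊛-comm (geom m) Mo ⟩
  Mo ⊛ geom m ∎)
  where
  open ≈R
  m = suc m'
  Mo = mono (r * m)
  Gm = geomInv ℤ.-1ℤ m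

prodTo-factor-earlyCandidate : ∀ r a' A' N k → (∀ j → j < k → candidate (suc a') (suc A') j ≤ N) →
  prodTo (factor r (earlyCandidate (suc a') (suc A') k)) N ≈ prodTo freeFactor N ⊛ blockingRatios r (suc a') (suc A') k
prodTo-factor-earlyCandidate r a' A' N zero _ = ≈-sym (⊛-identityʳ (prodTo freeFactor N))
prodTo-factor-earlyCandidate r a' A' N (suc k) bnd = begin
  prodTo (factor r (earlyCandidate a A (suc k))) N
    ≈⟨ prodTo-update N (factor r (earlyCandidate a A k)) (factor r (earlyCandidate a A (suc k))) (blockingRatio r a A k) m (s≤s z≤n) (bnd k (NP.n<1+n k)) diff same ⟩
  prodTo (factor r (earlyCandidate a A k)) N ⊛ blockingRatio r a A k ≈⟨ ⊛-congˡ (blockingRatio r a A k) (prodTo-factor-earlyCandidate r a' A' N k (λ j j<k → bnd j (NP.m<n⇒m<1+n j<k))) ⟩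
  (prodTo freeFactor N ⊛ blockingRatios r a A k) ⊛ blockingRatio r a A k ≈⟨ ⊛-assoc (prodTo freeFactor N) (blockingRatios r a A k) (blockingRatio r a A k) ⟩
  prodTo freeFactor N ⊛ blockingRatios r a A (suc k) ∎
  where
  open ≈R
  a = suc a'
  A = suc A'
  m = candidate a A k
  diff : ∀ s → s ≢ m → factor r (earlyCandidate a A (suc k)) s ≈ factor r (earlyCandidate a A k) s
  diff s ne n = cong (λ b → (if b then blockedFactor r s else freeFactor s) n) (trans (cong (earlyCandidate a A k s ∨_) (≡ᵇ-≢ s m ne)) (BP.∨-identityʳ _))
  gkm : earlyCandidate a A k m ≡ false
  gkm = earlyCandidate-false a A k m (λ j j<k e → NP.<-irrefl (candidate-injective a A' j k (sym e)) j<k)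
  same : factor r (earlyCandidate a A (suc k)) m ≈ factor r (earlyCandidate a A k) m ⊛ blockingRatio r a A k
  same n = trans (cong (λ b → (if b then blockedFactor r m else freeFactor m) n) (trans (cong (_∨ (m ≡ᵇ m)) gkm) (≡ᵇ-refl m)))
    (trans (blockedFactor≈freeFactor⊛blockingRatio r (a' + k * A) n) (cong (λ b → ((if b then blockedFactor r m else freeFactor m) ⊛ blockingRatio r a A k) n) (sym gkm)))

exponent : ℕ → ℕ → ℕ → ℕ → ℕ
exponent r A a k = r * (A * (k C 2) + k * a)

suc-C-2 : ∀ k → suc k C 2 ≡ k + k C 2
suc-C-2 k = trans (sym (nCk+nC[k+1]≡[n+1]C[k+1] k 1)) (cong (_+ k C 2) (nC1≡n k))

exponent-suc : ∀ r A a k → exponent r A a (suc k) ≡ exponent r A a k + r * candidate a A k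
exponent-suc r A a k rewrite suc-C-2 k =
  exponent-step r A a k (k C 2)
  where
  exponent-step : ∀ r A a k c → r * (A * (k + c) + suc k * a) ≡ r * (A * c + k * a) + r * (a + k * A)
  exponent-step = ℕ-Ring.solve-∀

summand≈blockingRatios : ∀ r A a k → summand r A a k ≈ blockingRatios r a A k
summand≈blockingRatios r A a zero = ≈-trans (⊛-congˡ one (λ n → cong (λ e → mono e n) e0)) (⊛-identityˡ one)
  where
  e0 : exponent r A a 0 ≡ 0
  e0 = trans (cong (λ x → r * (x + 0)) (NP.*-zeroʳ A)) (NP.*-zeroʳ r)
summand≈blockingRatios r A a (suc k) = begin
  mono (exponent r A a (suc k)) ⊛ invPoch A a (suc k) ≈⟨ ⊛-cong _ _ _ _ (λ n → cong (λ e → mono e n) (exponent-suc r A a k)) (invPoch-suc A a k) ⟩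
  mono (exponent r A a k + r * candidate a A k) ⊛ (invPoch A a k ⊛ geomInv ℤ.-1ℤ (candidate a A k))
    ≈⟨ ⊛-congˡ (invPoch A a k ⊛ geomInv ℤ.-1ℤ (candidate a A k)) (≈-sym (mono-mono (exponent r A a k) (r * candidate a A k))) ⟩
  (mono (exponent r A a k) ⊛ mono (r * candidate a A k)) ⊛ (invPoch A a k ⊛ geomInv ℤ.-1ℤ (candidate a A k))
    ≈⟨ ⊛-interchange (mono (exponent r A a k)) (mono (r * candidate a A k)) (invPoch A a k) (geomInv ℤ.-1ℤ (candidate a A k)) ⟩
  summand r A a k ⊛ blockingRatio r a A k ≈⟨ ⊛-congˡ (blockingRatio r a A k) (summand≈blockingRatios r A a k) ⟩
  blockingRatios r a A (suc k) ∎
  where open ≈R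

overGF⊛summand≈countBlockedSeries : ∀ r a' A' N k → 2 ≤ r → (∀ j → j < k → candidate (suc a') (suc A') j ≤ N) →
  overGF N ⊛ summand r (suc A') (suc a') k ≈ countBlockedSeries r (earlyCandidate (suc a') (suc A') k) N
overGF⊛summand≈countBlockedSeries r a' A' N k 2≤r bnd = begin
  overGF N ⊛ summand r A a k ≈⟨ ⊛-cong _ _ _ _ (overGF-prodTo N) (summand≈blockingRatios r A a k) ⟩
  prodTo freeFactor N ⊛ blockingRatios r a A k ≈⟨ ≈-sym (prodTo-factor-earlyCandidate r a' A' N k bnd) ⟩
  prodTo (factor r (earlyCandidate a A k)) N ≈⟨ ≈-sym (countBlockedSeries≈prodTo-factor r (earlyCandidate a A k) N 2≤r) ⟩
  countBlockedSeries r (earlyCandidate a A k) N ∎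
  where
  open ≈R
  a = suc a'
  A = suc A'

overGF⊛summand-coeff-below : ∀ r A a N k n → n < exponent r A a k → (overGF N ⊛ summand r A a k) n ≡ + 0
overGF⊛summand-coeff-below r A a N k n lt = trans (⊛-congʳ (overGF N) (mono-⊛ (exponent r A a k) (invPoch A a k)) n)
  (sumTo-zero (suc n) _ (λ j j<sn → trans (cong (overGF N j *ᶻ_) (shift-coeff-< _ _ _ (NP.≤-<-trans (NP.m∸n≤m n j) lt))) (ZP.*-zeroʳ (overGF N j))))

candidate≤exponent-suc : ∀ r A a k → 1 ≤ r → candidate a A k ≤ exponent r A a (suc k)
candidate≤exponent-suc r A a k 1≤r = subst (candidate a A k ≤_) (sym (exponent-suc r A a k))
  (NP.≤-trans (NP.m≤n*m (candidate a A k) r {{ℕ.>-nonZero 1≤r}}) (NP.m≤n+m _ _))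


-- The minimal excludant

module _ (r a A : ℕ) (π : OverPartition) where

  firstBlocked : ℕ → Bool
  firstBlocked zero = true
  firstBlocked (suc k) = firstBlocked k ∧ blocked r π (candidate a A k)

  countFirstBlocked : ℕ → ℕ → ℕ
  countFirstBlocked st zero = 0
  countFirstBlocked st (suc f) = toℕ (firstBlocked st) + countFirstBlocked (suc st) f

  firstBlocked-false-suc : ∀ k → firstBlocked k ≡ false → firstBlocked (suc k) ≡ false
  firstBlocked-false-suc k e rewrite e = refl

  countFirstBlocked-false : ∀ st f → firstBlocked st ≡ false → countFirstBlocked st f ≡ 0
  countFirstBlocked-false st zero e = refl
  countFirstBlocked-false st (suc f) e rewrite e = countFirstBlocked-false (suc st) f (firstBlocked-false-suc st e)

  mesSearch-firstBlocked : ∀ f j → firstBlocked j ≡ true → mesSearch r A π f (candidate a A j) ≡ candidate a A j + A * countFirstBlocked (suc j) f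
  mesSearch-firstBlocked zero j _ = sym (trans (cong (λ z → candidate a A j + z) (NP.*-zeroʳ A)) (NP.+-identityʳ _))
  mesSearch-firstBlocked (suc f) j cj with mesCond r π (candidate a A j) in eq
  ... | true rewrite cj = sym (trans (cong (λ z → candidate a A j + A * z) (countFirstBlocked-false (suc (suc j)) f (firstBlocked-false-suc (suc j) c1))) (trans (cong (λ z → candidate a A j + z) (NP.*-zeroʳ A)) (NP.+-identityʳ _)))
    where
    c1 : firstBlocked (suc j) ≡ false
    c1 rewrite cj | eq = refl
  ... | false rewrite cj = begin
    mesSearch r A π f (candidate a A j + A) ≡⟨ cong (mesSearch r A π f) e1 ⟩
    mesSearch r A π f (candidate a A (suc j)) ≡⟨ mesSearch-firstBlocked f (suc j) c1 ⟩
    candidate a A (suc j) + A * countFirstBlocked (suc (suc j)) f ≡⟨ shift-step a A j (countFirstBlocked (suc (suc j)) f) ⟩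
    candidate a A j + A * (1 + countFirstBlocked (suc (suc j)) f) ∎
    where
    open ≡-Reasoning
    c1 : firstBlocked (suc j) ≡ true
    c1 rewrite cj | eq = refl
    e1 : candidate a A j + A ≡ candidate a A (suc j)
    e1 = trans (NP.+-assoc a (j * A) A) (cong (λ z → a + z) (NP.+-comm (j * A) A))
    shift-step : ∀ a A j x → a + (A + j * A) + A * x ≡ a + j * A + A * (1 + x)
    shift-step = ℕ-Ring.solve-∀

  mes≡countFirstBlocked : mes r A a π ≡ a + A * countFirstBlocked 1 (suc (length π))
  mes≡countFirstBlocked = trans (cong (mesSearch r A π (suc (length π))) (sym (NP.+-identityʳ a)))
    (trans (mesSearch-firstBlocked (suc (length π)) 0 refl) (cong (λ z → z + A * countFirstBlocked 1 (suc (length π))) (NP.+-identityʳ a)))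

  firstBlocked⇒blocked : ∀ k j → firstBlocked k ≡ true → j < k → blocked r π (candidate a A j) ≡ true
  firstBlocked⇒blocked (suc k) j e j<k with firstBlocked k in ek | blocked r π (candidate a A k) in eg
  firstBlocked⇒blocked (suc k) j e j<k | true | true with j ≟ k
  ... | yes refl = eg
  ... | no ne = firstBlocked⇒blocked k j ek (NP.≤∧≢⇒< (NP.≤-pred j<k) ne)

  blocked⇒hasOver : ∀ m → blocked r π m ≡ true → hasOver π m ≡ true
  blocked⇒hasOver m e with hasOver π m
  ... | true = refl
  ... | false = e

  countFirstBlocked-stable : ∀ st d f → (∀ k → firstBlocked k ≡ true → k < st + d) → d ≤ f → countFirstBlocked st f ≡ countFirstBlocked st d
  countFirstBlocked-stable st zero f bnd _ with firstBlocked st in e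
  ... | true = ⊥-elim (NP.<-irrefl (sym (NP.+-identityʳ st)) (bnd st e))
  ... | false = countFirstBlocked-false st f e
  countFirstBlocked-stable st (suc d) (suc f) bnd (s≤s d≤f) =
    cong (λ z → toℕ (firstBlocked st) + z) (countFirstBlocked-stable (suc st) d f (λ k ck → subst (k <_) (NP.+-suc st d) (bnd k ck)) d≤f)

  countFirstBlocked-sum : ∀ f st (g : ℕ → ℕ) → (∀ i → g i ≡ st + i) → sumℕ (map (λ k → toℕ (firstBlocked k)) (applyUpTo g f)) ≡ countFirstBlocked st f
  countFirstBlocked-sum zero st g e = refl
  countFirstBlocked-sum (suc f) st g e = cong₂ _+_ (cong (λ z → toℕ (firstBlocked z)) (trans (e 0) (NP.+-identityʳ st)))
    (countFirstBlocked-sum f (suc st) (g ∘ suc) (λ i → trans (e (suc i)) (NP.+-suc st i)))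

-- The candidates c_0, …, c_{k−1} are distinct sizes of overlined parts; this is why the fuel in mes suffices.
firstBlocked-bound : ∀ r a A' π k → firstBlocked r a (suc A') π k ≡ true → k ≤ length π
firstBlocked-bound r a A' π k e = subst₂ _≤_ (trans (LP.length-map (candidate a (suc A')) (upTo k)) (LP.length-upTo k)) (LP.length-map size π)
  (Unique-⊆-length≤ (map (candidate a (suc A')) (upTo k)) (map size π) (UP.map⁺ (λ {i} {j} → candidate-injective a A' i j) (UP.upTo⁺ k)) sub)
  where
  sub : ∀ x → x ∈ map (candidate a (suc A')) (upTo k) → x ∈ map size π
  sub x p with MP.∈-map⁻ (candidate a (suc A')) p
  ... | j , j∈ , refl = hasOver⇒∈sizes π _ (blocked⇒hasOver r a (suc A') π _ (firstBlocked⇒blocked r a (suc A') π k j e (MP.∈-upTo⁻ j∈)))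

blockedOn-earlyCandidate : ∀ r a' A' N k π → (∀ j → j < k → candidate (suc a') (suc A') j ≤ N) →
  blockedOn r (earlyCandidate (suc a') (suc A') k) N π ≡ firstBlocked r (suc a') (suc A') π k
blockedOn-earlyCandidate r a' A' N zero π _ = blockedOn-nothing r N π
blockedOn-earlyCandidate r a' A' N (suc k) π bnd =
  trans (blockedOn-insert r (earlyCandidate (suc a') (suc A') k) (candidate (suc a') (suc A') k) N π (s≤s z≤n) (bnd k (NP.n<1+n k)))
    (cong (_∧ blocked r π (candidate (suc a') (suc A') k)) (blockedOn-earlyCandidate r a' A' N k π (λ j j<k → bnd j (NP.m<n⇒m<1+n j<k))))

count-firstBlocked-small : ∀ r a' A' N n k → 2 ≤ r → (∀ j → j < k → candidate (suc a') (suc A') j ≤ N) →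
  + count (λ π → firstBlocked r (suc a') (suc A') π k) (overpartitions≤ N n) ≡ (overGF N ⊛ summand r (suc A') (suc a') k) n
count-firstBlocked-small r a' A' N n k 2≤r bnd = sym (trans (overGF⊛summand≈countBlockedSeries r a' A' N k 2≤r bnd n)
  (cong +_ (sumℕ-cong∈ _ _ (overpartitions≤ N n) (λ π _ → cong toℕ (blockedOn-earlyCandidate r a' A' N k π bnd)))))

count-firstBlocked-large : ∀ r a A N n k → 1 ≤ r → n ≤ N → N < candidate a A k →
  + count (λ π → firstBlocked r a A π (suc k)) (overpartitions≤ N n) ≡ (overGF N ⊛ summand r A a (suc k)) n
count-firstBlocked-large r a A N n k 1≤r n≤N N<m = begin
  + count (λ π → firstBlocked r a A π (suc k)) (overpartitions≤ N n) ≡⟨ cong +_ (sumℕ-zeros _ (overpartitions≤ N n) none) ⟩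
  + 0                                                                  ≡⟨ sym (overGF⊛summand-coeff-below r A a N (suc k) n n<exponent) ⟩
  (overGF N ⊛ summand r A a (suc k)) n ∎
  where
  open ≡-Reasoning
  m = candidate a A k
  n<exponent : n < exponent r A a (suc k)
  n<exponent = NP.<-≤-trans (NP.≤-<-trans n≤N N<m) (candidate≤exponent-suc r A a k 1≤r)
  none : ∀ π → π ∈ overpartitions≤ N n → toℕ (firstBlocked r a A π (suc k)) ≡ 0
  none π π∈ with firstBlocked r a A π (suc k) in e
  ... | false = refl
  ... | true with MP.∈-map⁻ size (hasOver⇒∈sizes π m (blocked⇒hasOver r a A π m (firstBlocked⇒blocked r a A π (suc k) k e (NP.n<1+n k))))
  ...   | p , p∈ , refl = ⊥-elim (NP.<⇒≱ N<m (proj₂ (All.lookup (proj₁ (proj₁ (overpartitions≤-sound N n π π∈))) p∈)))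

count-firstBlocked≡coeff : ∀ r a' A' N n k → 2 ≤ r → n ≤ N →
  + count (λ π → firstBlocked r (suc a') (suc A') π k) (overpartitions≤ N n) ≡ (overGF N ⊛ summand r (suc A') (suc a') k) n
count-firstBlocked≡coeff r a' A' N n zero 2≤r n≤N = count-firstBlocked-small r a' A' N n 0 2≤r (λ _ ())
count-firstBlocked≡coeff r a' A' N n (suc k) 2≤r n≤N with candidate (suc a') (suc A') k ≤? N
... | yes m≤N = count-firstBlocked-small r a' A' N n (suc k) 2≤r
  (λ j j<k → NP.≤-trans (NP.+-monoʳ-≤ (suc a') (NP.*-monoˡ-≤ (suc A') (NP.≤-pred j<k))) m≤N)
... | no m≰N = count-firstBlocked-large r (suc a') (suc A') N n k (NP.≤-trans (s≤s z≤n) 2≤r) n≤N (NP.≰⇒> m≰N)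

mes≡firstBlocked-sum : ∀ r a A' π N → length π ≤ N →
  mes r (suc A') a π ≡ a + suc A' * sumℕ (map (λ k → toℕ (firstBlocked r a (suc A') π k)) (range1 N))
mes≡firstBlocked-sum r a A' π N len≤N = begin
  mes r A a π                       ≡⟨ mes≡countFirstBlocked r a A π ⟩
  a + A * countFirstBlocked r a A π 1 (suc ℓ) ≡⟨ cong (λ x → a + A * x) (trans (stable (suc ℓ) (NP.n≤1+n ℓ)) (sym (stable N len≤N))) ⟩
  a + A * countFirstBlocked r a A π 1 N       ≡⟨ cong (λ x → a + A * x) (sym (countFirstBlocked-sum r a A π N 1 suc (λ _ → refl))) ⟩
  a + A * sumℕ (map (λ k → toℕ (firstBlocked r a A π k)) (applyUpTo suc N)) ≡⟨ cong (λ ks → a + A * sumℕ (map (λ k → toℕ (firstBlocked r a A π k)) ks)) (sym (LP.map-upTo suc N)) ⟩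
  a + A * sumℕ (map (λ k → toℕ (firstBlocked r a A π k)) (range1 N)) ∎
  where
  open ≡-Reasoning
  A = suc A'
  ℓ = length π
  stable : ∀ f → ℓ ≤ f → countFirstBlocked r a A π 1 f ≡ countFirstBlocked r a A π 1 ℓ
  stable f = countFirstBlocked-stable r a A π 1 ℓ f (λ k e → s≤s (firstBlocked-bound r a A' π k e))

sum-mes : ∀ r a A' N n → n ≤ N →
  let #B = λ k → count (λ π → firstBlocked r a (suc A') π k) (overpartitions≤ N n) in
  sumℕ (map (mes r (suc A') a) (overpartitions≤ N n)) ≡ a * #B 0 + suc A' * sumℕ (map #B (range1 N))
sum-mes r a A' N n n≤N = begin
  sumℕ (map (mes r A a) O)                                        ≡⟨ sumℕ-cong∈ _ _ O mes≡ ⟩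
  sumℕ (map (λ π → a * toℕ (B π 0) + A * Y π) O)                  ≡⟨ sumℕ-+ (λ π → a * toℕ (B π 0)) (λ π → A * Y π) O ⟩
  sumℕ (map (λ π → a * toℕ (B π 0)) O) + sumℕ (map (λ π → A * Y π) O) ≡⟨ cong₂ _+_ (sumℕ-*ˡ (λ π → toℕ (B π 0)) a O) (sumℕ-*ˡ Y A O) ⟩
  a * count (λ π → B π 0) O + A * sumℕ (map Y O)                  ≡⟨ cong (λ x → a * count (λ π → B π 0) O + A * x) (sumℕ-swap (λ π k → toℕ (B π k)) O R) ⟩
  a * count (λ π → B π 0) O + A * sumℕ (map (λ k → count (λ π → B π k) O) R) ∎
  where
  open ≡-Reasoning
  A = suc A'
  O = overpartitions≤ N n
  R = range1 N
  B = firstBlocked r a A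
  Y : OverPartition → ℕ
  Y π = sumℕ (map (λ k → toℕ (B π k)) R)
  mes≡ : ∀ π → π ∈ O → mes r A a π ≡ a * toℕ (B π 0) + A * Y π
  mes≡ π π∈ with overpartitions≤-sound N n π π∈
  ... | (bounds , _) , sum≡n = trans (mes≡firstBlocked-sum r a A' π N len≤N) (cong (_+ A * Y π) (sym (NP.*-identityʳ a)))
    where
    len≤N : length π ≤ N
    len≤N = NP.≤-trans (length≤sumParts π (All.map proj₁ bounds)) (subst (_≤ N) (sym sum≡n) n≤N)

+-linearCombination : ∀ {X : Set} a A c (f : X → ℕ) xs →
  + (a * c + A * sumℕ (map f xs)) ≡ + a *ᶻ + c +ᶻ + A *ᶻ sumℤ (map (λ x → + f x) xs)
+-linearCombination a A c f xs = begin
  + (a * c + A * sumℕ (map f xs))                 ≡⟨ ZP.pos-+ (a * c) (A * sumℕ (map f xs)) ⟩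
  + (a * c) +ᶻ + (A * sumℕ (map f xs))            ≡⟨ cong₂ _+ᶻ_ (ZP.pos-* a c) (ZP.pos-* A (sumℕ (map f xs))) ⟩
  + a *ᶻ + c +ᶻ + A *ᶻ + sumℕ (map f xs)          ≡⟨ cong (λ x → + a *ᶻ + c +ᶻ + A *ᶻ x) (+-sumℕ f xs) ⟩
  + a *ᶻ + c +ᶻ + A *ᶻ sumℤ (map (λ x → + f x) xs) ∎
  where open ≡-Reasoning

theorem2p6 : (A a r : ℕ) → 1 ≤ a → a ≤ A → 2 ≤ r →
    (n : ℕ) (L : List OverPartition) → Unique L →
    (∀ π → (π ∈ L) ⇔ IsOverpartitionOf n π) →
    (N : ℕ) → n ≤ N →
    + σmes r A a L ≡ rhsTrunc r A a N n
theorem2p6 A@(suc A') a@(suc a') r (s≤s z≤n) (s≤s _) 2≤r n L uniq L⇔ N n≤N = begin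
  + σmes r A a L                      ≡⟨ cong +_ (sum-↭ (PermP.map⁺ (mes r A a) (↭-overpartitions≤ uniq L⇔ n≤N))) ⟩
  + sumℕ (map (mes r A a) O)          ≡⟨ cong +_ (sum-mes r a A' N n n≤N) ⟩
  + (a * #B 0 + A * sumℕ (map #B R))  ≡⟨ +-linearCombination a A (#B 0) #B R ⟩
  + a *ᶻ + #B 0 +ᶻ + A *ᶻ sumℤ (map (λ k → + #B k) R)
    ≡⟨ cong₂ (λ x y → + a *ᶻ x +ᶻ + A *ᶻ y)
         (trans (coeff 0) (trans (⊛-congʳ (overGF N) (summand≈blockingRatios r A a 0) n) (⊛-identityʳ (overGF N) n)))
         (sumℤ-cong∈ _ _ R (λ k _ → coeff k)) ⟩
  + a *ᶻ overGF N n +ᶻ + A *ᶻ sumℤ (map (λ k → (overGF N ⊛ summand r A a k) n) R) ≡⟨ rhsTrunc-coeff r A a N n ⟨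
  rhsTrunc r A a N n ∎
  where
  open ≡-Reasoning
  O = overpartitions≤ N n
  R = range1 N
  #B = λ k → count (λ π → firstBlocked r a A π k) O
  coeff : ∀ k → + #B k ≡ (overGF N ⊛ summand r A a k) n
  coeff k = count-firstBlocked≡coeff r a' A' N n k 2≤r n≤N
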